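{- Let $P\in\mathbb{F}_q[t]$ be irreducible of degree $d\ge 1$, let $e$ be a positive integer, and set $b_j=\frac{q^{dj}-1}{q^d-1}$ for $j\ge 1$. Then $e$ can be uniquely written as $$e=c_1b_{j_1}+c_2b_{j_2}+\dots+c_kb_{j_k}$$ with integers $j_1>j_2>\dots>j_k>0$, $1\le c_i<q^d$ for $i=1,\dots,k-1$, and $1\le c_k\le q^d$; and for this representation $$S(P^e)=\delta^{ -1}\big(c_1q^{dj_1}+c_2q^{dj_2}+\dots+c_kq^{dj_k}\big).$$
   Context: Let $\mathbb{F}_q$ be a finite field with $q$ elements ($q$ a prime power). Fix an enumeration $\mathbb{F}_q=\{a_0,a_1,\dots,a_{q-1}\}$ with $a_0=0$, $a_1=1$. Every nonzero $f\in\mathbb{F}_q[t]$ of degree $m$ is uniquely written $f=a_{i_0}+a_{i_1}t+\dots+a_{i_m}t^m$ with $0\le i_j\le q-1$, $a_{i_m}\neq 0$. Put $\delta(f)=i_0+i_1q+\dots+i_mq^m$ and $\delta(0)=0$; $\delta$ is a bijection from $\mathbb{F}_q[t]$ onto the non-negative integers, with inverse $\delta^{ -1}$. Order $\mathbb{F}_q[t]$ by: $f>g$ iff $\delta(f)>\delta(g)$. For nonzero $f$, $f!=\prod_{g<f}(f-g)$ (product over all $g\in\mathbb{F}_q[t]$ with $g<f$), and $0!=1$. For nonzero $f$, $S(f)$ is the smallest $g$ (in this order) with $f\mid g!$; $S(0)=0$. -}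

module Defs where

open import Level using (Level) renaming (suc to lsuc)
open import Data.Nat as ℕ using (ℕ; zero; suc; _∸_; _^_; _≤_; _<_)
open import Data.Nat.DivMod using (_/_; _%_; m%n<n)
open import Data.Fin as Fin using (Fin; toℕ; fromℕ<)
open import Data.Product using (Σ; ∃; _×_; _,_; proj₁; proj₂)
open import Data.Sum using (_⊎_)
open import Data.List using (List; []; _∷_; [_]; map; foldr; upTo; length)
open import Relation.Nullary using (¬_; Dec; yes; no)
open import Relation.Binary.PropositionalEquality using (_≡_; refl; cong; sym; trans)
open import Relation.Binary.Definitions using (DecidableEquality)
open import Algebra.Structures using (IsCommutativeRing)
open import Function.Bundles using (_↔_; Inverse)

-- A finite field 𝔽_q together with a fixed enumeration
-- 𝔽_q = {a_0, …, a_{q-1}} with a_0 = 0, a_1 = 1.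
-- Field equality is propositional equality.

record FiniteField (ℓ : Level) : Set (lsuc ℓ) where
  infixl 7 _*_
  infixl 6 _+_
  field
    Carrier : Set ℓ
    _+_ _*_ : Carrier → Carrier → Carrier
    -_      : Carrier → Carrier
    0# 1#   : Carrier
    isCommutativeRing : IsCommutativeRing _≡_ _+_ _*_ -_ 0# 1#
    0≢1     : ¬ (0# ≡ 1#)
    inverse : ∀ x → ¬ (x ≡ 0#) → ∃ λ y → x * y ≡ 1#
    q       : ℕ
    enum    : Fin q ↔ Carrier
    enum-0  : ∀ i → toℕ i ≡ 0 → Inverse.to enum i ≡ 0#
    enum-1  : ∀ i → toℕ i ≡ 1 → Inverse.to enum i ≡ 1#

-- Polynomials over 𝔽_q, as coefficient lists (constant term first).
-- Two lists denote the same polynomial iff they agree after removing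
-- trailing zero coefficients.

module Poly {ℓ : Level} (F : FiniteField ℓ) where
  open FiniteField F

  a : Fin q → Carrier
  a = Inverse.to enum

  index : Carrier → Fin q
  index = Inverse.from enum

  _≟_ : DecidableEquality Carrier
  x ≟ y with index x Fin.≟ index y
  ... | yes p = yes (trans (sym (Inverse.strictlyInverseˡ enum x))
                      (trans (cong a p) (Inverse.strictlyInverseˡ enum y)))
  ... | no ¬p = no (λ x≡y → ¬p (cong index x≡y))

  Pol : Set ℓ
  Pol = List Carrier

  trim : Pol → Pol
  trim [] = []
  trim (c ∷ cs) with trim cs
  ... | (d ∷ ds) = c ∷ d ∷ ds
  ... | [] with c ≟ 0#
  ...   | yes _ = []
  ...   | no _  = [ c ]

  _≈P_ : Pol → Pol → Set ℓ
  f ≈P g = trim f ≡ trim g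

  _+P_ : Pol → Pol → Pol
  [] +P g = g
  (c ∷ f) +P [] = c ∷ f
  (c ∷ f) +P (d ∷ g) = (c + d) ∷ (f +P g)

  -P_ : Pol → Pol
  -P f = map -_ f

  _-P_ : Pol → Pol → Pol
  f -P g = f +P (-P g)

  _*P_ : Pol → Pol → Pol
  [] *P g = []
  (c ∷ f) *P g = map (c *_) g +P (0# ∷ (f *P g))

  1P : Pol
  1P = [ 1# ]

  _^P_ : Pol → ℕ → Pol
  f ^P zero = 1P
  f ^P suc n = f *P (f ^P n)

  productP : List Pol → Pol
  productP = foldr _*P_ 1P

  -- degree (the zero polynomial gets degree 0; only used for nonzero f)
  deg : Pol → ℕ
  deg f = length (trim f) ∸ 1

  IsZero : Pol → Set ℓ
  IsZero f = trim f ≡ []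

  _∣P_ : Pol → Pol → Set ℓ
  f ∣P g = ∃ λ h → (f *P h) ≈P g

  -- irreducible: nonzero, non-unit (degree ≥ 1), and every factorisation
  -- has a unit factor (units of 𝔽_q[t] = nonzero constants = degree 0).
  Irreducible : Pol → Set ℓ
  Irreducible P = ¬ IsZero P × 1 ≤ deg P
                × (∀ g h → P ≈P (g *P h) → deg g ≡ 0 ⊎ deg h ≡ 0)

  δ : Pol → ℕ
  δ [] = 0
  δ (c ∷ cs) = toℕ (index c) ℕ.+ q ℕ.* δ cs

  step : ℕ → Carrier × ℕ
  step m with q | a
  ... | zero  | _  = 0# , 0
  ... | suc k | a' = a' (fromℕ< (m%n<n m (suc k))) , m / suc k

  -- δ⁻¹ : base-q digits (fuel n suffices since q ≥ 2); any extra
  -- trailing zero coefficients are harmless (a_0 = 0).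
  δ⁻¹ : ℕ → Pol
  δ⁻¹ n = go n n
    where
    go : ℕ → ℕ → Pol
    go zero m = []
    go (suc fuel) m = proj₁ (step m) ∷ go fuel (proj₂ (step m))

  -- f! = ∏_{g < f} (f - g)  =  ∏_{n < δ f} (f - δ⁻¹ n);  0! = 1
  _! : Pol → Pol
  f ! = productP (map (λ n → f -P δ⁻¹ n) (upTo (δ f)))

  IsS : Pol → Pol → Set ℓ
  IsS f g = (f ∣P (g !)) × (∀ h → δ h < δ g → ¬ (f ∣P (h !)))

-- The numbers b_j = (Q^j - 1)/(Q - 1) with Q = q^d, and representations
-- e = c_1 b_{j_1} + … + c_k b_{j_k}, encoded as lists of pairs (c_i , j_i).

divℕ : ℕ → ℕ → ℕ
divℕ m zero = 0
divℕ m (suc n) = m / suc n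

bNum : (Q j : ℕ) → ℕ
bNum Q j = divℕ (Q ^ j ∸ 1) (Q ∸ 1)

data ValidRep (Q : ℕ) : List (ℕ × ℕ) → Set where
  lastTerm : ∀ {c j} → 1 ≤ c → c ≤ Q → 1 ≤ j → ValidRep Q [ (c , j) ]
  consTerm : ∀ {c j c' j' R} → 1 ≤ c → c < Q → j' < j
           → ValidRep Q ((c' , j') ∷ R) → ValidRep Q ((c , j) ∷ (c' , j') ∷ R)

repValue : (Q : ℕ) → List (ℕ × ℕ) → ℕ
repValue Q [] = 0
repValue Q ((c , j) ∷ R) = c ℕ.* bNum Q j ℕ.+ repValue Q R

repPower : (Q : ℕ) → List (ℕ × ℕ) → ℕ
repPower Q [] = 0
repPower Q ((c , j) ∷ R) = c ℕ.* Q ^ j ℕ.+ repPower Q R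

-- Write Q = q^d. For a polynomial M of degree D, the polynomials δ⁻¹ m with
-- m in a block [b Q^D, (b+1) Q^D) run through all residues modulo M, so among
-- the δ(g) factors g − h of g! exactly ⌊δ(g) / q^D⌋ are divisible by M.
-- Since an irreducible P is prime, taking M = P^k and summing over k gives
-- Legendre's formula: P^e ∣ g! iff e ≤ L(δ g), where
-- L(n) = ⌊n / Q⌋ + ⌊n / Q²⌋ + ….  Hence S(P^e) = δ⁻¹ N for the least N with
-- L(N) ≥ e. For N = Σ cᵢ Q^jᵢ built from the representation of e, one has
-- L(N) ≥ Σ cᵢ b_jᵢ = e and L(N − 1) < e, because each digit c < Q at position
-- j contributes exactly c b_j. The representation comes from the greedy
-- algorithm, and it is unique because c₁ and the tail are the quotient and
-- remainder of e by b_j₁.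
module Submission where

open import Defs
open import Level using (Level)
open import Data.Nat as Nat using (ℕ; zero; suc; _≤_; _<_; _^_; z≤n; s≤s; NonZero)
import Data.Nat.Properties as ℕₚ
open import Data.Nat.DivMod
open import Data.Nat.Divisibility using (divides)
open import Data.Nat.Tactic.RingSolver using (solve-∀)
open import Data.Fin using (Fin; toℕ; fromℕ<)
open import Data.Fin.Properties using (toℕ-fromℕ<; toℕ-injective; toℕ<n)
open import Function.Bundles using (Inverse)
open import Relation.Binary.Definitions using (tri<; tri≈; tri>)
open import Data.List using (List; []; _∷_; [_]; _++_; _∷ʳ_; map; drop; upTo; length)
open import Data.List.Properties using (upTo-∷ʳ)
open import Data.Product using (Σ; ∃; _×_; _,_; proj₁; proj₂)
open import Data.Sum as Sum using (_⊎_; inj₁; inj₂; [_,_]′)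
open import Data.Empty using (⊥-elim)
open import Relation.Nullary using (¬_; Dec; yes; no)
open import Relation.Binary.PropositionalEquality hiding ([_])
open import Relation.Binary.Structures using (IsEquivalence)
open import Algebra.Bundles using (CommutativeRing)
open import Algebra.Structures using (IsCommutativeRing)
import Algebra.Properties.Ring as RingProperties
import Algebra.Properties.CommutativeSemigroup as CommutativeSemigroupProperties
import Algebra.Properties.Group as GroupProperties
import Algebra.Properties.AbelianGroup as AbelianGroupProperties
import Relation.Binary.Reasoning.Setoid as SetoidReasoning

module Arithmetic where
  open Nat using (_+_; _*_; _∸_)
  open ℕₚ

  base-< : ∀ b {x y u v} → x < b → u < v → x + b * u < y + b * v
  base-< b {x} {y} {u} {v} x<b u<v = <-≤-trans (+-monoˡ-< (b * u) x<b)
    (≤-trans (≤-reflexive (sym (*-suc b u))) (≤-trans (*-monoʳ-≤ b u<v) (m≤n+m (b * v) y)))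

  ∸1< : ∀ {n} → 0 < n → n ∸ 1 < n
  ∸1< {suc n} _ = n<1+n n

  <⇒≤∸1 : ∀ {m n} → m < n → m ≤ n ∸ 1
  <⇒≤∸1 (s≤s m≤n) = m≤n

  base-unique : ∀ b {x y u v} → x < b → y < b → x + b * u ≡ y + b * v → x ≡ y × u ≡ v
  base-unique b {x} {y} {u} {v} x<b y<b e with <-cmp u v
  ... | tri< u<v _ _ = ⊥-elim (<-irrefl e (base-< b x<b u<v))
  ... | tri≈ _ refl _ = +-cancelʳ-≡ (b * u) x y e , refl
  ... | tri> _ _ v<u = ⊥-elim (<-irrefl (sym e) (base-< b y<b v<u))

module FiniteSums where
  open Nat using (_+_; _*_)
  open ℕₚ
  open CommutativeSemigroupProperties +-commutativeSemigroup using () renaming (interchange to +-interchange)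

  ∑ : (ℕ → ℕ) → ℕ → ℕ
  ∑ f zero    = 0
  ∑ f (suc n) = ∑ f n + f n

  ∑ᴸ : (ℕ → ℕ) → List ℕ → ℕ
  ∑ᴸ f []       = 0
  ∑ᴸ f (m ∷ ms) = f m + ∑ᴸ f ms

  𝟙 : ∀ {p} {A : Set p} → Dec A → ℕ
  𝟙 (yes _) = 1
  𝟙 (no _)  = 0

  𝟙-yes : ∀ {p} {A : Set p} → A → (a? : Dec A) → 𝟙 a? ≡ 1
  𝟙-yes a (yes _) = refl
  𝟙-yes a (no ¬a) = ⊥-elim (¬a a)

  𝟙-no : ∀ {p} {A : Set p} → ¬ A → (a? : Dec A) → 𝟙 a? ≡ 0
  𝟙-no ¬a (yes a) = ⊥-elim (¬a a)
  𝟙-no ¬a (no _)  = refl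

  ∑ᴸ-++ : ∀ f ms ns → ∑ᴸ f (ms ++ ns) ≡ ∑ᴸ f ms + ∑ᴸ f ns
  ∑ᴸ-++ f []       ns = refl
  ∑ᴸ-++ f (m ∷ ms) ns = trans (cong (f m +_) (∑ᴸ-++ f ms ns)) (sym (+-assoc (f m) _ _))

  ∑ᴸ-upTo : ∀ f n → ∑ᴸ f (upTo n) ≡ ∑ f n
  ∑ᴸ-upTo f zero    = refl
  ∑ᴸ-upTo f (suc n) = begin
      ∑ᴸ f (upTo (suc n))        ≡⟨ cong (∑ᴸ f) (upTo-∷ʳ n) ⟨
      ∑ᴸ f (upTo n ∷ʳ n)         ≡⟨ ∑ᴸ-++ f (upTo n) [ n ] ⟩
      ∑ᴸ f (upTo n) + (f n + 0)  ≡⟨ cong₂ _+_ (∑ᴸ-upTo f n) (+-identityʳ (f n)) ⟩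
      ∑ f n + f n                ∎
    where open ≡-Reasoning

  ∑ᴸ-+ : ∀ f g ms → ∑ᴸ (λ m → f m + g m) ms ≡ ∑ᴸ f ms + ∑ᴸ g ms
  ∑ᴸ-+ f g []       = refl
  ∑ᴸ-+ f g (m ∷ ms) = trans (cong (f m + g m +_) (∑ᴸ-+ f g ms)) (+-interchange (f m) (g m) _ _)

  ∑ᴸ-mono : ∀ {f g} ms → (∀ m → f m ≤ g m) → ∑ᴸ f ms ≤ ∑ᴸ g ms
  ∑ᴸ-mono []       f≤g = z≤n
  ∑ᴸ-mono (m ∷ ms) f≤g = +-mono-≤ (f≤g m) (∑ᴸ-mono ms f≤g)

  ∑ᴸ-∑-comm : ∀ (f : ℕ → ℕ → ℕ) ms n → ∑ᴸ (λ m → ∑ (λ k → f k m) n) ms ≡ ∑ (λ k → ∑ᴸ (f k) ms) n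
  ∑ᴸ-∑-comm f ms zero    = ∑ᴸ-0 ms
    where
    ∑ᴸ-0 : ∀ ms → ∑ᴸ (λ _ → 0) ms ≡ 0
    ∑ᴸ-0 []       = refl
    ∑ᴸ-0 (m ∷ ms) = ∑ᴸ-0 ms
  ∑ᴸ-∑-comm f ms (suc n) =
    trans (∑ᴸ-+ (λ m → ∑ (λ k → f k m) n) (f n) ms) (cong (_+ ∑ᴸ (f n) ms) (∑ᴸ-∑-comm f ms n))

  ∑-cong : ∀ {f g} n → (∀ i → i < n → f i ≡ g i) → ∑ f n ≡ ∑ g n
  ∑-cong zero    f≡g = refl
  ∑-cong (suc n) f≡g = cong₂ _+_ (∑-cong n (λ i i<n → f≡g i (m≤n⇒m≤1+n i<n))) (f≡g n ≤-refl)

  ∑-monoʳ : ∀ f {m n} → m ≤ n → ∑ f m ≤ ∑ f n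
  ∑-monoʳ f {m} {zero}  z≤n = z≤n
  ∑-monoʳ f {m} {suc n} m≤1+n with m≤n⇒m<n∨m≡n m≤1+n
  ... | inj₁ m<1+n = ≤-trans (∑-monoʳ f (≤-pred m<1+n)) (m≤m+n (∑ f n) (f n))
  ... | inj₂ refl  = ≤-refl

  ∑-+ : ∀ f m n → ∑ f (m + n) ≡ ∑ f m + ∑ (λ i → f (m + i)) n
  ∑-+ f m zero    = trans (cong (∑ f) (+-identityʳ m)) (sym (+-identityʳ (∑ f m)))
  ∑-+ f m (suc n) = trans (cong (∑ f) (+-suc m n)) (trans (cong (_+ f (m + n)) (∑-+ f m n)) (+-assoc (∑ f m) _ _))

  ∑-* : ∀ f m n → ∑ f (m * n) ≡ ∑ (λ b → ∑ (λ l → f (b * n + l)) n) m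
  ∑-* f zero    n = refl
  ∑-* f (suc m) n = trans (cong (∑ f) (+-comm n (m * n)))
    (trans (∑-+ f (m * n) n) (cong (_+ ∑ (λ i → f (m * n + i)) n) (∑-* f m n)))

  ∑-const : ∀ c n → ∑ (λ _ → c) n ≡ n * c
  ∑-const c zero    = refl
  ∑-const c (suc n) = trans (cong (_+ c) (∑-const c n)) (+-comm (n * c) c)

  ∑-zero : ∀ {f} n → (∀ i → i < n → f i ≡ 0) → ∑ f n ≡ 0
  ∑-zero n f≡0 = trans (∑-cong n f≡0) (trans (∑-const 0 n) (*-zeroʳ n))

  ∑-𝟙-unique : ∀ {p} {A : ℕ → Set p} (a? : ∀ l → Dec (A l)) l₀ n → l₀ < n → A l₀
             → (∀ l → l < n → A l → l ≡ l₀) → ∑ (λ l → 𝟙 (a? l)) n ≡ 1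
  ∑-𝟙-unique a? l₀ (suc n) l₀<1+n Al₀ unique with <-cmp l₀ n
  ... | tri< l₀<n _ _ = cong₂ _+_ (∑-𝟙-unique a? l₀ n l₀<n Al₀ (λ l l<n → unique l (m≤n⇒m≤1+n l<n)))
                          (𝟙-no (λ An → <-irrefl (sym (unique n ≤-refl An)) l₀<n) (a? n))
  ... | tri≈ _ refl _ = cong₂ _+_
    (∑-zero n (λ i i<n → 𝟙-no (λ Ai → <-irrefl (unique i (m≤n⇒m≤1+n i<n) Ai) i<n) (a? i)))
    (𝟙-yes Al₀ (a? n))
  ... | tri> _ _ n<l₀ = ⊥-elim (<-irrefl refl (<-≤-trans n<l₀ (≤-pred l₀<1+n)))

module Polynomial {ℓ : Level} (F : FiniteField ℓ) where
  open FiniteField F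
  open Poly F
  open IsCommutativeRing isCommutativeRing
    using (+-assoc; +-comm; +-identityˡ; +-identityʳ; *-comm; *-assoc; zeroˡ; zeroʳ; distribˡ; -‿inverseʳ; *-identityˡ)

  field-ring : CommutativeRing ℓ ℓ
  field-ring = record { isCommutativeRing = isCommutativeRing }

  open RingProperties (CommutativeRing.ring field-ring) using (-0#≈0#)
  open CommutativeSemigroupProperties (CommutativeRing.+-commutativeSemigroup field-ring)
    using (interchange; x∙yz≈y∙xz)

  coeff : Pol → ℕ → Carrier
  coeff []      i       = 0#
  coeff (c ∷ f) zero    = c
  coeff (c ∷ f) (suc i) = coeff f i

  -- Equality of polynomials as functions of the coefficient index; unlike
  -- _≈P_ it ignores the representation, so the ring laws are pointwise.
  infix 4 _≋_
  record _≋_ (f g : Pol) : Set ℓ where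
    constructor mk≋
    field
      at : ∀ i → coeff f i ≡ coeff g i
  open _≋_ public

  ≋-refl : ∀ {f} → f ≋ f
  ≋-refl = mk≋ λ _ → refl

  ≋-sym : ∀ {f g} → f ≋ g → g ≋ f
  ≋-sym p = mk≋ λ i → sym (at p i)

  ≋-trans : ∀ {f g h} → f ≋ g → g ≋ h → f ≋ h
  ≋-trans p r = mk≋ λ i → trans (at p i) (at r i)

  ≋-reflexive : ∀ {f g} → f ≡ g → f ≋ g
  ≋-reflexive refl = ≋-refl

  ≋-isEquivalence : IsEquivalence _≋_
  ≋-isEquivalence = record { refl = ≋-refl ; sym = ≋-sym ; trans = ≋-trans }

  ∷-cong : ∀ {c d f g} → c ≡ d → f ≋ g → (c ∷ f) ≋ (d ∷ g)
  ∷-cong p r = mk≋ λ { zero → p ; (suc i) → at r i }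

  ∷-injectiveʳ : ∀ {c d f g} → (c ∷ f) ≋ (d ∷ g) → f ≋ g
  ∷-injectiveʳ p = mk≋ λ i → at p (suc i)

  shift : Pol → Pol
  shift f = 0# ∷ f

  infixr 7 _·P_
  _·P_ : Carrier → Pol → Pol
  c ·P f = map (c *_) f

  coeff-+P : ∀ f g i → coeff (f +P g) i ≡ coeff f i + coeff g i
  coeff-+P []      g       i       = sym (+-identityˡ _)
  coeff-+P (c ∷ f) []      i       = sym (+-identityʳ _)
  coeff-+P (c ∷ f) (d ∷ g) zero    = refl
  coeff-+P (c ∷ f) (d ∷ g) (suc i) = coeff-+P f g i

  coeff-negP : ∀ f i → coeff (-P f) i ≡ - coeff f i
  coeff-negP []      i       = sym -0#≈0#
  coeff-negP (c ∷ f) zero    = refl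
  coeff-negP (c ∷ f) (suc i) = coeff-negP f i

  coeff-·P : ∀ c f i → coeff (c ·P f) i ≡ c * coeff f i
  coeff-·P c []      i       = sym (zeroʳ c)
  coeff-·P c (d ∷ f) zero    = refl
  coeff-·P c (d ∷ f) (suc i) = coeff-·P c f i

  +P-cong : ∀ {f f′ g g′} → f ≋ f′ → g ≋ g′ → (f +P g) ≋ (f′ +P g′)
  +P-cong {f} {f′} {g} {g′} p r = mk≋ λ i →
    trans (coeff-+P f g i) (trans (cong₂ _+_ (at p i) (at r i)) (sym (coeff-+P f′ g′ i)))

  -P-cong : ∀ {f f′} → f ≋ f′ → (-P f) ≋ (-P f′)
  -P-cong {f} {f′} p = mk≋ λ i →
    trans (coeff-negP f i) (trans (cong -_ (at p i)) (sym (coeff-negP f′ i)))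

  ·P-congʳ : ∀ c {f f′} → f ≋ f′ → (c ·P f) ≋ (c ·P f′)
  ·P-congʳ c {f} {f′} p = mk≋ λ i →
    trans (coeff-·P c f i) (trans (cong (c *_) (at p i)) (sym (coeff-·P c f′ i)))

  ·P-congˡ : ∀ {c c′} f → c ≡ c′ → (c ·P f) ≋ (c′ ·P f)
  ·P-congˡ f refl = ≋-refl

  shift-cong : ∀ {f f′} → f ≋ f′ → shift f ≋ shift f′
  shift-cong = ∷-cong refl

  +P-comm : ∀ f g → (f +P g) ≋ (g +P f)
  +P-comm f g = mk≋ λ i →
    trans (coeff-+P f g i) (trans (+-comm _ _) (sym (coeff-+P g f i)))

  +P-assoc : ∀ f g h → ((f +P g) +P h) ≋ (f +P (g +P h))
  +P-assoc f g h = mk≋ λ i → begin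
      coeff ((f +P g) +P h) i              ≡⟨ coeff-+P (f +P g) h i ⟩
      coeff (f +P g) i + coeff h i         ≡⟨ cong (_+ coeff h i) (coeff-+P f g i) ⟩
      coeff f i + coeff g i + coeff h i    ≡⟨ +-assoc _ _ _ ⟩
      coeff f i + (coeff g i + coeff h i)  ≡⟨ cong (coeff f i +_) (coeff-+P g h i) ⟨
      coeff f i + coeff (g +P h) i         ≡⟨ coeff-+P f (g +P h) i ⟨
      coeff (f +P (g +P h)) i              ∎
    where open ≡-Reasoning

  +P-identityˡ : ∀ f → ([] +P f) ≋ f
  +P-identityˡ f = ≋-refl

  +P-identityʳ : ∀ f → (f +P []) ≋ f
  +P-identityʳ []      = ≋-refl
  +P-identityʳ (c ∷ f) = ≋-refl

  -P-inverseʳ : ∀ f → (f +P (-P f)) ≋ []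
  -P-inverseʳ f = mk≋ λ i →
    trans (coeff-+P f (-P f) i) (trans (cong (coeff f i +_) (coeff-negP f i)) (-‿inverseʳ _))

  -P-inverseˡ : ∀ f → ((-P f) +P f) ≋ []
  -P-inverseˡ f = ≋-trans (+P-comm (-P f) f) (-P-inverseʳ f)

  +P-≋[]ʳ : ∀ f {g} → g ≋ [] → (f +P g) ≋ f
  +P-≋[]ʳ f g≋0 = ≋-trans (+P-cong (≋-refl {f}) g≋0) (+P-identityʳ f)

  +P-interchange : ∀ f g h k → ((f +P g) +P (h +P k)) ≋ ((f +P h) +P (g +P k))
  +P-interchange f g h k = mk≋ λ i → begin
      coeff ((f +P g) +P (h +P k)) i
        ≡⟨ trans (coeff-+P (f +P g) (h +P k) i) (cong₂ _+_ (coeff-+P f g i) (coeff-+P h k i)) ⟩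
      (coeff f i + coeff g i) + (coeff h i + coeff k i)
        ≡⟨ interchange _ _ _ _ ⟩
      (coeff f i + coeff h i) + (coeff g i + coeff k i)
        ≡⟨ trans (coeff-+P (f +P h) (g +P k) i) (cong₂ _+_ (coeff-+P f h i) (coeff-+P g k i)) ⟨
      coeff ((f +P h) +P (g +P k)) i ∎
    where open ≡-Reasoning

  +P-left-comm : ∀ f g h → (f +P (g +P h)) ≋ (g +P (f +P h))
  +P-left-comm f g h = mk≋ λ i → begin
      coeff (f +P (g +P h)) i              ≡⟨ trans (coeff-+P f _ i) (cong (coeff f i +_) (coeff-+P g h i)) ⟩
      coeff f i + (coeff g i + coeff h i)  ≡⟨ x∙yz≈y∙xz _ _ _ ⟩
      coeff g i + (coeff f i + coeff h i)  ≡⟨ trans (coeff-+P g _ i) (cong (coeff g i +_) (coeff-+P f h i)) ⟨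
      coeff (g +P (f +P h)) i              ∎
    where open ≡-Reasoning

  shift-+P : ∀ f g → shift (f +P g) ≋ (shift f +P shift g)
  shift-+P f g = ∷-cong (sym (+-identityˡ 0#)) ≋-refl

  ·P-distrib-+P : ∀ c f g → (c ·P (f +P g)) ≋ ((c ·P f) +P (c ·P g))
  ·P-distrib-+P c f g = mk≋ λ i → begin
      coeff (c ·P (f +P g)) i              ≡⟨ trans (coeff-·P c (f +P g) i) (cong (c *_) (coeff-+P f g i)) ⟩
      c * (coeff f i + coeff g i)          ≡⟨ distribˡ c _ _ ⟩
      c * coeff f i + c * coeff g i
        ≡⟨ trans (coeff-+P (c ·P f) (c ·P g) i) (cong₂ _+_ (coeff-·P c f i) (coeff-·P c g i)) ⟨
      coeff ((c ·P f) +P (c ·P g)) i       ∎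
    where open ≡-Reasoning

  ·P-shift : ∀ c f → (c ·P shift f) ≋ shift (c ·P f)
  ·P-shift c f = ∷-cong (zeroʳ c) ≋-refl

  ·P-assoc : ∀ c d f → (c ·P (d ·P f)) ≋ ((c * d) ·P f)
  ·P-assoc c d f = mk≋ λ i →
    trans (coeff-·P c (d ·P f) i) (trans (cong (c *_) (coeff-·P d f i))
      (trans (sym (*-assoc _ _ _)) (sym (coeff-·P (c * d) f i))))

  ·P-zeroˡ : ∀ f → (0# ·P f) ≋ []
  ·P-zeroˡ f = mk≋ λ i → trans (coeff-·P 0# f i) (zeroˡ _)

  ·P-identityˡ : ∀ f → (1# ·P f) ≋ f
  ·P-identityˡ f = mk≋ λ i → trans (coeff-·P 1# f i) (*-identityˡ _)

  shift-[] : shift [] ≋ []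
  shift-[] = mk≋ λ { zero → refl ; (suc i) → refl }

  *P-zeroˡ : ∀ {f} g → f ≋ [] → (f *P g) ≋ []
  *P-zeroˡ {[]}    g p = ≋-refl
  *P-zeroˡ {c ∷ f} g p =
    ≋-trans (+P-cong c·g≋0 (shift-cong (*P-zeroˡ {f} g (mk≋ λ i → at p (suc i))))) shift-[]
    where
    c·g≋0 : (c ·P g) ≋ []
    c·g≋0 = ≋-trans (·P-congˡ g (at p 0)) (·P-zeroˡ g)

  *P-congˡ : ∀ {f f′} g → f ≋ f′ → (f *P g) ≋ (f′ *P g)
  *P-congˡ {[]}    {f′}      g p = ≋-sym (*P-zeroˡ g (≋-sym p))
  *P-congˡ {c ∷ f} {[]}      g p = *P-zeroˡ g p
  *P-congˡ {c ∷ f} {c′ ∷ f′} g p =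
    +P-cong (·P-congˡ g (at p 0)) (shift-cong (*P-congˡ g (∷-injectiveʳ p)))

  *P-congʳ : ∀ f {g g′} → g ≋ g′ → (f *P g) ≋ (f *P g′)
  *P-congʳ []      p = ≋-refl
  *P-congʳ (c ∷ f) p = +P-cong (·P-congʳ c p) (shift-cong (*P-congʳ f p))

  *P-cong : ∀ {f f′ g g′} → f ≋ f′ → g ≋ g′ → (f *P g) ≋ (f′ *P g′)
  *P-cong {f} {f′} {g} p r = ≋-trans (*P-congˡ g p) (*P-congʳ f′ r)

  *P-zeroʳ : ∀ f → (f *P []) ≋ []
  *P-zeroʳ []      = ≋-refl
  *P-zeroʳ (c ∷ f) = ≋-trans (shift-cong (*P-zeroʳ f)) shift-[]

  *P-∷ʳ : ∀ f d g → (f *P (d ∷ g)) ≋ ((d ·P f) +P shift (f *P g))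
  *P-∷ʳ []      d g = ≋-sym shift-[]
  *P-∷ʳ (c ∷ f) d g = ∷-cong
    (trans (+-identityʳ _) (trans (*-comm c d) (sym (+-identityʳ _))))
    (≋-trans (+P-cong (≋-refl {c ·P g}) (*P-∷ʳ f d g)) (+P-left-comm (c ·P g) (d ·P f) (shift (f *P g))))

  *P-comm : ∀ f g → (f *P g) ≋ (g *P f)
  *P-comm []      g = ≋-sym (*P-zeroʳ g)
  *P-comm (c ∷ f) g = ≋-trans (+P-cong (≋-refl {c ·P g}) (shift-cong (*P-comm f g))) (≋-sym (*P-∷ʳ g c f))

  *P-distribˡ : ∀ f g h → (f *P (g +P h)) ≋ ((f *P g) +P (f *P h))
  *P-distribˡ []      g h = ≋-refl
  *P-distribˡ (c ∷ f) g h =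
    ≋-trans (+P-cong (·P-distrib-+P c g h) (≋-trans (shift-cong (*P-distribˡ f g h)) (shift-+P (f *P g) (f *P h))))
            (+P-interchange (c ·P g) (c ·P h) (shift (f *P g)) (shift (f *P h)))

  *P-distribʳ : ∀ f g h → ((g +P h) *P f) ≋ ((g *P f) +P (h *P f))
  *P-distribʳ f g h =
    ≋-trans (*P-comm (g +P h) f) (≋-trans (*P-distribˡ f g h) (+P-cong (*P-comm f g) (*P-comm f h)))

  shift-*P : ∀ f g → (shift f *P g) ≋ shift (f *P g)
  shift-*P f g = +P-cong (·P-zeroˡ g) (≋-refl {shift (f *P g)})

  ·P-*P : ∀ c f g → ((c ·P f) *P g) ≋ (c ·P (f *P g))
  ·P-*P c []      g = ≋-refl
  ·P-*P c (d ∷ f) g =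
    ≋-trans (+P-cong (≋-sym (·P-assoc c d g)) (shift-cong (·P-*P c f g)))
            (≋-sym (≋-trans (·P-distrib-+P c (d ·P g) (shift (f *P g)))
                            (+P-cong (≋-refl {c ·P (d ·P g)}) (·P-shift c (f *P g)))))

  *P-assoc : ∀ f g h → ((f *P g) *P h) ≋ (f *P (g *P h))
  *P-assoc []      g h = ≋-refl
  *P-assoc (c ∷ f) g h =
    ≋-trans (*P-distribʳ h (c ·P g) (shift (f *P g)))
            (+P-cong (·P-*P c g h) (≋-trans (shift-*P (f *P g) h) (shift-cong (*P-assoc f g h))))

  *P-identityˡ : ∀ f → (1P *P f) ≋ f
  *P-identityˡ f = ≋-trans (+P-cong (·P-identityˡ f) shift-[]) (+P-identityʳ f)

  *P-identityʳ : ∀ f → (f *P 1P) ≋ f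
  *P-identityʳ f = ≋-trans (*P-comm f 1P) (*P-identityˡ f)

  isCommutativeRingP : IsCommutativeRing _≋_ _+P_ _*P_ -P_ [] 1P
  isCommutativeRingP = record
    { isRing = record
      { +-isAbelianGroup = record
        { isGroup = record
          { isMonoid = record
            { isSemigroup = record
              { isMagma = record { isEquivalence = ≋-isEquivalence ; ∙-cong = +P-cong }
              ; assoc = +P-assoc }
            ; identity = +P-identityˡ , +P-identityʳ }
          ; inverse = -P-inverseˡ , -P-inverseʳ
          ; ⁻¹-cong = -P-cong }
        ; comm = +P-comm }
      ; *-cong = *P-cong
      ; *-assoc = *P-assoc
      ; *-identity = *P-identityˡ , *P-identityʳ
      ; distrib = *P-distribˡ , *P-distribʳ }
    ; *-comm = *P-comm }

  polynomial-ring : CommutativeRing ℓ ℓ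
  polynomial-ring = record { isCommutativeRing = isCommutativeRingP }


module Degree {ℓ : Level} (F : FiniteField ℓ) where
  open FiniteField F
  open Poly F
  open Polynomial F
  open IsCommutativeRing isCommutativeRing using (+-identityˡ; *-comm; *-assoc; zeroˡ; zeroʳ; *-identityˡ)
  open RingProperties (CommutativeRing.ring field-ring) using (-0#≈0#)

  x*y≡0⇒x≡0⊎y≡0 : ∀ {x y} → x * y ≡ 0# → x ≡ 0# ⊎ y ≡ 0#
  x*y≡0⇒x≡0⊎y≡0 {x} {y} xy≡0 with x ≟ 0#
  ... | yes x≡0 = inj₁ x≡0
  ... | no  x≢0 with inverse x x≢0
  ...   | z , xz≡1 = inj₂ (begin
      y            ≡⟨ *-identityˡ y ⟨
      1# * y       ≡⟨ cong (_* y) (trans (sym xz≡1) (*-comm x z)) ⟩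
      (z * x) * y  ≡⟨ *-assoc z x y ⟩
      z * (x * y)  ≡⟨ cong (z *_) xy≡0 ⟩
      z * 0#       ≡⟨ zeroʳ z ⟩
      0#           ∎)
    where open ≡-Reasoning

  -- deg f < n; the zero polynomial satisfies it for every n
  record DegreeBelow (n : ℕ) (f : Pol) : Set ℓ where
    constructor degreeBelow
    field
      vanish : ∀ i → n ≤ i → coeff f i ≡ 0#
  open DegreeBelow public

  record HasDegree (m : ℕ) (f : Pol) : Set ℓ where
    field
      lead≢0 : ¬ coeff f m ≡ 0#
      below  : DegreeBelow (suc m) f
  open HasDegree public

  DegreeBelow-resp : ∀ {n f g} → f ≋ g → DegreeBelow n f → DegreeBelow n g
  DegreeBelow-resp p b = degreeBelow λ i n≤i → trans (sym (at p i)) (vanish b i n≤i)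

  HasDegree-resp : ∀ {m f g} → f ≋ g → HasDegree m f → HasDegree m g
  HasDegree-resp p t = record
    { lead≢0 = λ e → lead≢0 t (trans (at p _) e) ; below = DegreeBelow-resp p (below t) }

  DegreeBelow-0⇒≋[] : ∀ {f} → DegreeBelow 0 f → f ≋ []
  DegreeBelow-0⇒≋[] b = mk≋ λ i → vanish b i z≤n

  ≋[]⇒DegreeBelow : ∀ {n f} → f ≋ [] → DegreeBelow n f
  ≋[]⇒DegreeBelow p = degreeBelow λ i _ → at p i

  HasDegree⇒≢[] : ∀ {m f} → HasDegree m f → ¬ f ≋ []
  HasDegree⇒≢[] {m} t z = lead≢0 t (at z m)

  DegreeBelow-∷ : ∀ {n c f} → DegreeBelow n f → DegreeBelow (suc n) (c ∷ f)
  DegreeBelow-∷ b = degreeBelow λ { zero () ; (suc i) (s≤s n≤i) → vanish b i n≤i }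

  DegreeBelow-tail : ∀ {n c f} → DegreeBelow (suc n) (c ∷ f) → DegreeBelow n f
  DegreeBelow-tail b = degreeBelow λ i n≤i → vanish b (suc i) (s≤s n≤i)

  DegreeBelow-+P : ∀ {n f g} → DegreeBelow n f → DegreeBelow n g → DegreeBelow n (f +P g)
  DegreeBelow-+P {f = f} {g} bf bg = degreeBelow λ i n≤i →
    trans (coeff-+P f g i) (trans (cong₂ _+_ (vanish bf i n≤i) (vanish bg i n≤i)) (+-identityˡ 0#))

  DegreeBelow-negP : ∀ {n f} → DegreeBelow n f → DegreeBelow n (-P f)
  DegreeBelow-negP {f = f} bf = degreeBelow λ i n≤i →
    trans (coeff-negP f i) (trans (cong -_ (vanish bf i n≤i)) -0#≈0#)

  DegreeBelow-·P : ∀ {n} c {f} → DegreeBelow n f → DegreeBelow n (c ·P f)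
  DegreeBelow-·P c {f} bf = degreeBelow λ i n≤i →
    trans (coeff-·P c f i) (trans (cong (c *_) (vanish bf i n≤i)) (zeroʳ c))

  DegreeBelow-sub : ∀ {n f g} → DegreeBelow n f → DegreeBelow n g → DegreeBelow n (f -P g)
  DegreeBelow-sub bf bg = DegreeBelow-+P bf (DegreeBelow-negP bg)

  DegreeBelow-lower : ∀ {n f} → DegreeBelow (suc n) f → coeff f n ≡ 0# → DegreeBelow n f
  DegreeBelow-lower {n} {f} b fn≡0 = degreeBelow λ i n≤i → vanishing i (ℕₚ.m≤n⇒m<n∨m≡n n≤i)
    where
    vanishing : ∀ i → n < i ⊎ n ≡ i → coeff f i ≡ 0#
    vanishing i (inj₁ n<i)  = vanish b i n<i
    vanishing i (inj₂ refl) = fn≡0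

  ≋[]⊎HasDegree : ∀ f → f ≋ [] ⊎ ∃ λ m → HasDegree m f
  ≋[]⊎HasDegree []      = inj₁ ≋-refl
  ≋[]⊎HasDegree (c ∷ f) with ≋[]⊎HasDegree f
  ... | inj₂ (m , t) = inj₂ (suc m , record { lead≢0 = lead≢0 t ; below = DegreeBelow-∷ (below t) })
  ... | inj₁ f≋[] with c ≟ 0#
  ...   | yes c≡0 = inj₁ (≋-trans (∷-cong c≡0 f≋[]) shift-[])
  ...   | no  c≢0 = inj₂ (0 , record { lead≢0 = c≢0 ; below = DegreeBelow-∷ (≋[]⇒DegreeBelow f≋[]) })

  HasDegree⇒< : ∀ {m n f} → HasDegree m f → DegreeBelow n f → m < n
  HasDegree⇒< {m} {n} t b with m ℕₚ.<? n
  ... | yes m<n = m<n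
  ... | no  m≮n = ⊥-elim (lead≢0 t (vanish b m (ℕₚ.≮⇒≥ m≮n)))

  DegreeBelow-mono : ∀ {m n f} → m ≤ n → DegreeBelow m f → DegreeBelow n f
  DegreeBelow-mono m≤n b = degreeBelow λ i n≤i → vanish b i (ℕₚ.≤-trans m≤n n≤i)

  ∷-*P-const : ∀ c {f} g → f ≋ [] → ((c ∷ f) *P g) ≋ (c ·P g)
  ∷-*P-const c {f} g f≋[] =
    +P-≋[]ʳ (c ·P g) (≋-trans (shift-cong (*P-zeroˡ g f≋[])) shift-[])

  *P-DegreeBelow : ∀ {f g} a b → DegreeBelow (suc a) f → DegreeBelow (suc b) g
                 → DegreeBelow (suc (a Nat.+ b)) (f *P g)
  *P-DegreeBelow {[]}    a       b bf bg = ≋[]⇒DegreeBelow ≋-refl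
  *P-DegreeBelow {c ∷ f} {g} zero b bf bg =
    DegreeBelow-resp (≋-sym (∷-*P-const c g (DegreeBelow-0⇒≋[] (DegreeBelow-tail bf)))) (DegreeBelow-·P c bg)
  *P-DegreeBelow {c ∷ f} (suc a) b bf bg =
    DegreeBelow-+P (DegreeBelow-·P c (DegreeBelow-mono (s≤s (ℕₚ.m≤n+m b (suc a))) bg))
                   (DegreeBelow-∷ (*P-DegreeBelow a b (DegreeBelow-tail bf) bg))

  coeff-*P-top : ∀ f g a b → DegreeBelow (suc a) f → DegreeBelow (suc b) g
               → coeff (f *P g) (a Nat.+ b) ≡ coeff f a * coeff g b
  coeff-*P-top []      g a       b bf bg = sym (zeroˡ _)
  coeff-*P-top (c ∷ f) g zero    b bf bg =
    trans (at (∷-*P-const c g (DegreeBelow-0⇒≋[] (DegreeBelow-tail bf))) b) (coeff-·P c g b)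
  coeff-*P-top (c ∷ f) g (suc a) b bf bg = begin
      coeff ((c ·P g) +P shift (f *P g)) (suc (a Nat.+ b))
        ≡⟨ coeff-+P (c ·P g) (shift (f *P g)) (suc (a Nat.+ b)) ⟩
      coeff (c ·P g) (suc (a Nat.+ b)) + coeff (f *P g) (a Nat.+ b)
        ≡⟨ cong₂ _+_ (vanish (DegreeBelow-·P c bg) (suc (a Nat.+ b)) (s≤s (ℕₚ.m≤n+m b a)))
                     (coeff-*P-top f g a b (DegreeBelow-tail bf) bg) ⟩
      0# + coeff f a * coeff g b
        ≡⟨ +-identityˡ _ ⟩
      coeff f a * coeff g b ∎
    where open ≡-Reasoning

  *P-HasDegree : ∀ {f g a b} → HasDegree a f → HasDegree b g → HasDegree (a Nat.+ b) (f *P g)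
  *P-HasDegree {f} {g} {a} {b} tf tg = record
    { lead≢0 = λ top≡0 → [ lead≢0 tf , lead≢0 tg ]′
        (x*y≡0⇒x≡0⊎y≡0 (trans (sym (coeff-*P-top f g a b (below tf) (below tg))) top≡0))
    ; below  = *P-DegreeBelow a b (below tf) (below tg) }

  *P-≢[] : ∀ {f g} → ¬ f ≋ [] → ¬ g ≋ [] → ¬ (f *P g) ≋ []
  *P-≢[] {f} {g} f≢0 g≢0 with ≋[]⊎HasDegree f | ≋[]⊎HasDegree g
  ... | inj₁ f≋0       | _              = ⊥-elim (f≢0 f≋0)
  ... | _              | inj₁ g≋0       = ⊥-elim (g≢0 g≋0)
  ... | inj₂ (a , tf)  | inj₂ (b , tg)  = HasDegree⇒≢[] (*P-HasDegree tf tg)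


module Divisibility {ℓ : Level} (F : FiniteField ℓ) where
  open FiniteField F
  open Poly F
  open Polynomial F
  open Degree F
  open IsCommutativeRing isCommutativeRing using (+-identityˡ; *-comm; *-assoc; *-identityʳ; -‿inverseʳ)
  open CommutativeRing polynomial-ring using (+-group; +-abelianGroup; ring; *-commutativeSemigroup)
    renaming (setoid to ≋-setoid)
  open GroupProperties +-group using (x∙y⁻¹≈ε⇒x≈y; x≈y⇒x∙y⁻¹≈ε; //-rightDividesˡ)
  open AbelianGroupProperties +-abelianGroup using (xyx⁻¹≈y)
  open RingProperties ring using (-‿distribʳ-*; x[y-z]≈xy-xz)
  open CommutativeSemigroupProperties *-commutativeSemigroup using (interchange)
  open SetoidReasoning ≋-setoid

  infix 4 _∣_
  record _∣_ (M f : Pol) : Set ℓ where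
    constructor divides
    field
      quotient : Pol
      equation : (M *P quotient) ≋ f
  open _∣_ public

  ∣-respʳ : ∀ {M f g} → f ≋ g → M ∣ f → M ∣ g
  ∣-respʳ p (divides h e) = divides h (≋-trans e p)

  ∣-respˡ : ∀ {M M′ f} → M ≋ M′ → M ∣ f → M′ ∣ f
  ∣-respˡ p (divides h e) = divides h (≋-trans (*P-congˡ h (≋-sym p)) e)

  ∣-refl : ∀ {M} → M ∣ M
  ∣-refl {M} = divides 1P (*P-identityʳ M)

  ∣-*Pʳ : ∀ M g → M ∣ (M *P g)
  ∣-*Pʳ M g = divides g ≋-refl

  1P-∣ : ∀ f → 1P ∣ f
  1P-∣ f = divides f (*P-identityˡ f)

  ∣-+P : ∀ {M f g} → M ∣ f → M ∣ g → M ∣ (f +P g)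
  ∣-+P {M} (divides h e) (divides h′ e′) = divides (h +P h′) (≋-trans (*P-distribˡ M h h′) (+P-cong e e′))

  ∣-negP : ∀ {M f} → M ∣ f → M ∣ (-P f)
  ∣-negP {M} (divides h e) = divides (-P h) (≋-trans (≋-sym (-‿distribʳ-* M h)) (-P-cong e))

  ∣-sub : ∀ {M f g} → M ∣ f → M ∣ g → M ∣ (f -P g)
  ∣-sub d d′ = ∣-+P d (∣-negP d′)

  ∣-*P : ∀ {M f} g → M ∣ f → M ∣ (f *P g)
  ∣-*P {M} g (divides h e) = divides (h *P g) (≋-trans (≋-sym (*P-assoc M h g)) (*P-congˡ g e))

  ∣-*P′ : ∀ {M g} f → M ∣ g → M ∣ (f *P g)
  ∣-*P′ {g = g} f d = ∣-respʳ (*P-comm g f) (∣-*P f d)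

  ∣-trans : ∀ {A B f} → A ∣ B → B ∣ f → A ∣ f
  ∣-trans {A} (divides h e) (divides h′ e′) =
    divides (h *P h′) (≋-trans (≋-sym (*P-assoc A h h′)) (≋-trans (*P-congˡ h′ e) e′))

  *P-pres-∣ : ∀ {A B f g} → A ∣ f → B ∣ g → (A *P B) ∣ (f *P g)
  *P-pres-∣ {A} {B} (divides h e) (divides h′ e′) =
    divides (h *P h′) (≋-trans (interchange A B h h′) (*P-cong e e′))

  sub-≋[]⇒≋ : ∀ {f g} → (f -P g) ≋ [] → f ≋ g
  sub-≋[]⇒≋ {f} {g} = x∙y⁻¹≈ε⇒x≈y f g

  *P-cancelˡ : ∀ {M A B} → ¬ M ≋ [] → (M *P A) ≋ (M *P B) → A ≋ B
  *P-cancelˡ {M} {A} {B} M≢0 MA≋MB with ≋[]⊎HasDegree (A -P B)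
  ... | inj₁ A-B≋0 = sub-≋[]⇒≋ A-B≋0
  ... | inj₂ (m , t) = ⊥-elim (*P-≢[] M≢0 (HasDegree⇒≢[] t)
                         (≋-trans (x[y-z]≈xy-xz M A B) (x≈y⇒x∙y⁻¹≈ε MA≋MB)))

  ∣∧DegreeBelow⇒≋[] : ∀ {D M f} → HasDegree D M → DegreeBelow D f → M ∣ f → f ≋ []
  ∣∧DegreeBelow⇒≋[] {D} {M} {f} tM bf (divides h e) with ≋[]⊎HasDegree h
  ... | inj₁ h≋0 = ≋-trans (≋-sym e) (≋-trans (*P-congʳ M h≋0) (*P-zeroʳ M))
  ... | inj₂ (j , th) = ⊥-elim (ℕₚ.<-irrefl refl
         (ℕₚ.≤-trans (HasDegree⇒< (HasDegree-resp e (*P-HasDegree tM th)) bf) (ℕₚ.m≤m+n D j)))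

  +P-sub-cancel : ∀ f g → (g +P (f -P g)) ≋ f
  +P-sub-cancel f g = ≋-trans (+P-comm g (f -P g)) (//-rightDividesˡ g f)

  +P-sub-cancelˡ : ∀ f g → ((f +P g) -P f) ≋ g
  +P-sub-cancelˡ = xyx⁻¹≈y

  [_]-*P : ∀ c f → ([ c ] *P f) ≋ (c ·P f)
  [ c ]-*P f = +P-≋[]ʳ (c ·P f) shift-[]

  *P-[_] : ∀ c f → (f *P [ c ]) ≋ (c ·P f)
  *P-[ c ] f = ≋-trans (*P-comm f [ c ]) ([ c ]-*P f)

  *P-shiftʳ : ∀ f g → (f *P shift g) ≋ shift (f *P g)
  *P-shiftʳ f g = ≋-trans (*P-comm f (shift g)) (≋-trans (shift-*P g f) (shift-cong (*P-comm g f)))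

  DegreeBelow-1⇒≋[coeff0] : ∀ {f} → DegreeBelow 1 f → f ≋ [ coeff f 0 ]
  DegreeBelow-1⇒≋[coeff0] b = mk≋ λ { zero → refl ; (suc i) → vanish b (suc i) (s≤s z≤n) }

  record Division (M f : Pol) (D : ℕ) : Set ℓ where
    constructor division
    field
      quot rem : Pol
      quot-rem : f ≋ ((M *P quot) +P rem)
      rem-deg  : DegreeBelow D rem

  exact-division : ∀ {M f u r} → f ≋ ((M *P u) +P r) → r ≋ [] → M ∣ f
  exact-division {M} {u = u} f≋Mu+r r≋0 = divides u (≋-sym (≋-trans f≋Mu+r (+P-≋[]ʳ (M *P u) r≋0)))

  divide : ∀ {D M} → HasDegree D M → ∀ f → Division M f D
  divide {D} {M} tM [] =
    division [] [] (≋-sym (≋-trans (+P-identityʳ (M *P [])) (*P-zeroʳ M))) (≋[]⇒DegreeBelow ≋-refl)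
  divide {D} {M} tM (c ∷ f) with divide tM f | inverse (coeff M D) (lead≢0 tM)
  ... | division u r f≋Mu+r r-deg | y , lead*y≡1 =
    division (shift u +P [ κ ]) (s -P (κ ·P M)) equation′ degree′
    where
    s : Pol
    s = c ∷ r
    -- κ · M cancels the coefficient of t^D in s
    κ : Carrier
    κ = coeff s D * y
    κ*lead≡s_D : κ * coeff M D ≡ coeff s D
    κ*lead≡s_D = trans (*-assoc _ y _) (trans (cong (coeff s D *_) (trans (*-comm y _) lead*y≡1)) (*-identityʳ _))
    equation′ : (c ∷ f) ≋ ((M *P (shift u +P [ κ ])) +P (s -P (κ ·P M)))
    equation′ = begin
      c ∷ f                                                 ≈⟨ ∷-cong (sym (+-identityˡ c)) f≋Mu+r ⟩
      shift (M *P u) +P s                                   ≈⟨ +P-cong (≋-sym (*P-shiftʳ M u)) (≋-sym (+P-sub-cancel s (κ ·P M))) ⟩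
      (M *P shift u) +P ((κ ·P M) +P (s -P (κ ·P M)))      ≈⟨ +P-assoc (M *P shift u) (κ ·P M) _ ⟨
      ((M *P shift u) +P (κ ·P M)) +P (s -P (κ ·P M))      ≈⟨ +P-cong (+P-cong (≋-refl {M *P shift u}) (*P-[ κ ] M)) ≋-refl ⟨
      ((M *P shift u) +P (M *P [ κ ])) +P (s -P (κ ·P M))  ≈⟨ +P-cong (*P-distribˡ M (shift u) [ κ ]) ≋-refl ⟨
      (M *P (shift u +P [ κ ])) +P (s -P (κ ·P M))         ∎
    degree′ : DegreeBelow D (s -P (κ ·P M))
    degree′ = DegreeBelow-lower (DegreeBelow-sub (DegreeBelow-∷ r-deg) (DegreeBelow-·P κ (below tM)))
      (trans (coeff-+P s (-P (κ ·P M)) D) (trans (cong (coeff s D +_) (trans (coeff-negP (κ ·P M) D)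
        (cong -_ (trans (coeff-·P κ M D) κ*lead≡s_D)))) (-‿inverseʳ _)))

  ∣-dec : ∀ {D M} → HasDegree D M → ∀ f → Dec (M ∣ f)
  ∣-dec {D} {M} tM f with divide tM f
  ... | division u r f≋Mu+r r-deg with ≋[]⊎HasDegree r
  ...   | inj₁ r≋0 = yes (exact-division f≋Mu+r r≋0)
  ...   | inj₂ (m , t) = no λ M∣f →
    HasDegree⇒≢[] t (∣∧DegreeBelow⇒≋[] tM r-deg (∣-respʳ r≋f-Mu (∣-sub M∣f (∣-*Pʳ M u))))
    where
    r≋f-Mu : (f -P (M *P u)) ≋ r
    r≋f-Mu = ≋-trans (+P-cong f≋Mu+r (≋-refl { -P (M *P u)})) (+P-sub-cancelˡ (M *P u) r)

  ∣-sub⇒≋ : ∀ {D M f g} → HasDegree D M → DegreeBelow D f → DegreeBelow D g → M ∣ (f -P g) → f ≋ g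
  ∣-sub⇒≋ M-deg bf bg M∣f-g = sub-≋[]⇒≋ (∣∧DegreeBelow⇒≋[] M-deg (DegreeBelow-sub bf bg) M∣f-g)

  ∣-·P : ∀ {M f} c → M ∣ f → M ∣ (c ·P f)
  ∣-·P {f = f} c M∣f = ∣-respʳ ([ c ]-*P f) (∣-*P′ [ c ] M∣f)

  *P-cancel-∣ : ∀ {M A B} → ¬ M ≋ [] → (M *P A) ∣ (M *P B) → A ∣ B
  *P-cancel-∣ {M} {A} M≢0 (divides h e) = divides h (*P-cancelˡ M≢0 (≋-trans (≋-sym (*P-assoc M A h)) e))

  *P-remainder : ∀ {f r} g h b → f ≋ ((g *P h) +P r) → ((f *P b) -P (h *P (g *P b))) ≋ (r *P b)
  *P-remainder {f} {r} g h b f≋gh+r = begin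
      (f *P b) -P (h *P (g *P b))                      ≈⟨ +P-cong (*P-congˡ b f≋gh+r) ≋-refl ⟩
      (((g *P h) +P r) *P b) -P (h *P (g *P b))        ≈⟨ +P-cong (*P-distribʳ b (g *P h) r) ≋-refl ⟩
      (((g *P h) *P b) +P (r *P b)) -P (h *P (g *P b)) ≈⟨ +P-cong (+P-cong gh·b≋h·gb ≋-refl) ≋-refl ⟩
      ((h *P (g *P b)) +P (r *P b)) -P (h *P (g *P b)) ≈⟨ +P-sub-cancelˡ (h *P (g *P b)) (r *P b) ⟩
      r *P b                                            ∎
    where
    gh·b≋h·gb : ((g *P h) *P b) ≋ (h *P (g *P b))
    gh·b≋h·gb = ≋-trans (*P-congˡ b (*P-comm g h)) (*P-assoc h g b)


module Canonical {ℓ : Level} (F : FiniteField ℓ) where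
  open FiniteField F
  open Poly F
  open Polynomial F
  open Degree F
  open Divisibility F
  open Nat using (_∸_)

  data Canonical : Pol → Set ℓ where
    []  : Canonical []
    _∷_ : ∀ {c f} → (f ≡ [] → ¬ c ≡ 0#) → Canonical f → Canonical (c ∷ f)

  trim-≋ : ∀ f → trim f ≋ f
  trim-≋ []       = ≋-refl
  trim-≋ (c ∷ cs) with trim cs | trim-≋ cs
  ... | d ∷ ds | p = ∷-cong refl p
  ... | []     | p with c ≟ 0#
  ...   | yes c≡0 = ≋-sym (≋-trans (∷-cong c≡0 (≋-sym p)) shift-[])
  ...   | no  _   = ∷-cong refl p

  trim-Canonical : ∀ f → Canonical (trim f)
  trim-Canonical []       = []
  trim-Canonical (c ∷ cs) with trim cs | trim-Canonical cs
  ... | d ∷ ds | can = (λ ()) ∷ can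
  ... | []     | can with c ≟ 0#
  ...   | yes _   = []
  ...   | no  c≢0 = (λ _ → c≢0) ∷ []

  Canonical-≋⇒≡ : ∀ {f g} → Canonical f → Canonical g → f ≋ g → f ≡ g
  Canonical-≋⇒≡ []            []            p = refl
  Canonical-≋⇒≡ []            (d≢0 ∷ can-g) p with Canonical-≋⇒≡ [] can-g (mk≋ λ i → at p (suc i))
  ... | refl = ⊥-elim (d≢0 refl (sym (at p 0)))
  Canonical-≋⇒≡ (c≢0 ∷ can-f) []            p with Canonical-≋⇒≡ can-f [] (mk≋ λ i → at p (suc i))
  ... | refl = ⊥-elim (c≢0 refl (at p 0))
  Canonical-≋⇒≡ (_ ∷ can-f)   (_ ∷ can-g)   p = cong₂ _∷_ (at p 0) (Canonical-≋⇒≡ can-f can-g (∷-injectiveʳ p))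

  ≋⇒≈P : ∀ {f g} → f ≋ g → f ≈P g
  ≋⇒≈P {f} {g} p =
    Canonical-≋⇒≡ (trim-Canonical f) (trim-Canonical g) (≋-trans (trim-≋ f) (≋-trans p (≋-sym (trim-≋ g))))

  ≈P⇒≋ : ∀ {f g} → f ≈P g → f ≋ g
  ≈P⇒≋ {f} {g} e = ≋-trans (≋-sym (trim-≋ f)) (≋-trans (≋-reflexive e) (trim-≋ g))

  ∣P⇒∣ : ∀ {M f} → M ∣P f → M ∣ f
  ∣P⇒∣ (h , e) = divides h (≈P⇒≋ e)

  ∣⇒∣P : ∀ {M f} → M ∣ f → M ∣P f
  ∣⇒∣P (divides h e) = h , ≋⇒≈P e

  Canonical-HasDegree : ∀ {f} → Canonical f → ¬ f ≡ [] → HasDegree (length f ∸ 1) f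
  Canonical-HasDegree []                  f≢[] = ⊥-elim (f≢[] refl)
  Canonical-HasDegree {c ∷ []} (c≢0 ∷ _)  _    =
    record { lead≢0 = c≢0 refl ; below = DegreeBelow-∷ (≋[]⇒DegreeBelow ≋-refl) }
  Canonical-HasDegree {c ∷ d ∷ ds} (_ ∷ can) _ with Canonical-HasDegree can (λ ())
  ... | t = record { lead≢0 = lead≢0 t ; below = DegreeBelow-∷ (below t) }

  deg≡0⇒DegreeBelow-1 : ∀ {g} → deg g ≡ 0 → DegreeBelow 1 g
  deg≡0⇒DegreeBelow-1 {g} deg≡0 = DegreeBelow-resp (trim-≋ g) (length≤1 (trim g) (ℕₚ.m∸n≡0⇒m≤n deg≡0))
    where
    length≤1 : ∀ f → length f ≤ 1 → DegreeBelow 1 f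
    length≤1 []          _ = ≋[]⇒DegreeBelow ≋-refl
    length≤1 (c ∷ [])    _ = DegreeBelow-∷ (≋[]⇒DegreeBelow ≋-refl)
    length≤1 (c ∷ d ∷ f) (s≤s ())

  Irreducible⇒HasDegree : ∀ {P d} → Irreducible P → deg P ≡ d → HasDegree d P
  Irreducible⇒HasDegree {P} (P≢0 , _ , _) refl =
    HasDegree-resp (trim-≋ P) (Canonical-HasDegree (trim-Canonical P) P≢0)

  Irreducible⇒factor-constant : ∀ {P} → Irreducible P → ∀ g h → P ≋ (g *P h) → DegreeBelow 1 g ⊎ DegreeBelow 1 h
  Irreducible⇒factor-constant (_ , _ , factor-unit) g h P≋gh =
    Sum.map deg≡0⇒DegreeBelow-1 deg≡0⇒DegreeBelow-1 (factor-unit g h (≋⇒≈P P≋gh))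


module IrreducibleIsPrime {ℓ : Level} (F : FiniteField ℓ) (P : Poly.Pol F) {d : ℕ}
  (P-irr : Poly.Irreducible F P) (deg-P : Poly.deg F P ≡ d) where
  open FiniteField F
  open Poly F
  open Polynomial F
  open Degree F
  open Divisibility F
  open Canonical F
  open IsCommutativeRing isCommutativeRing using (*-comm)

  P-deg : HasDegree d P
  P-deg = Irreducible⇒HasDegree P-irr deg-P

  P≢0 : ¬ P ≋ []
  P≢0 = HasDegree⇒≢[] P-deg

  no-factor-of-degree-between : ∀ {m a s} → HasDegree (suc m) a → suc m < d → ¬ P ≋ (a *P s)
  no-factor-of-degree-between {m} {a} {s} ta m<d P≋as with Irreducible⇒factor-constant P-irr a s P≋as
  ... | inj₁ a-const = ℕₚ.<-irrefl refl (ℕₚ.<-≤-trans (HasDegree⇒< ta a-const) (s≤s z≤n))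
  ... | inj₂ s-const =
    ℕₚ.<-irrefl refl (ℕₚ.<-≤-trans m<d (ℕₚ.≤-trans (ℕₚ.≤-pred d<as) (ℕₚ.≤-reflexive (ℕₚ.+-identityʳ (suc m)))))
    where
    d<as : d < suc (suc m Nat.+ 0)
    d<as = HasDegree⇒< P-deg (DegreeBelow-resp (≋-sym P≋as) (*P-DegreeBelow (suc m) 0 (below ta) s-const))

  -- Euclid's descent: P ∣ a b with 0 < deg a < d persists when a is
  -- replaced by the remainder of P modulo a, whose degree is smaller.
  P∣ab⇒P∣b : ∀ fuel {m a} b → m < fuel → HasDegree m a → m < d → P ∣ (a *P b) → P ∣ b
  P∣ab⇒P∣b (suc fuel) {zero} {a} b _ ta _ P∣ab with inverse (coeff a 0) (lead≢0 ta)
  ... | y , a₀y≡1 = ∣-respʳ y·a₀b≋b (∣-·P y (∣-respʳ ab≋a₀b P∣ab))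
    where
    ab≋a₀b : (a *P b) ≋ (coeff a 0 ·P b)
    ab≋a₀b = ≋-trans (*P-congˡ b (DegreeBelow-1⇒≋[coeff0] (below ta))) ([ coeff a 0 ]-*P b)
    y·a₀b≋b : (y ·P (coeff a 0 ·P b)) ≋ b
    y·a₀b≋b = ≋-trans (·P-assoc y _ b) (≋-trans (·P-congˡ b (trans (*-comm y _) a₀y≡1)) (·P-identityˡ b))
  P∣ab⇒P∣b (suc fuel) {suc m} {a} b (s≤s m<fuel) ta m<d P∣ab with divide ta P
  ... | division s r P≋as+r r-deg with ≋[]⊎HasDegree r
  ...   | inj₁ r≋0 = ⊥-elim (no-factor-of-degree-between ta m<d
                       (≋-trans P≋as+r (+P-≋[]ʳ (a *P s) r≋0)))
  ...   | inj₂ (k , tr) = P∣ab⇒P∣b fuel b (ℕₚ.<-≤-trans k<sm m<fuel) tr (ℕₚ.<-trans k<sm m<d)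
                            (∣-respʳ (*P-remainder a s b P≋as+r) (∣-sub (∣-*P b ∣-refl) (∣-*P′ s P∣ab)))
    where
    k<sm : k < suc m
    k<sm = HasDegree⇒< tr r-deg

  irreducible⇒prime : ∀ a b → P ∣ (a *P b) → P ∣ a ⊎ P ∣ b
  irreducible⇒prime a b P∣ab with divide P-deg a
  ... | division t r a≋Pt+r r-deg with ≋[]⊎HasDegree r
  ...   | inj₁ r≋0 = inj₁ (exact-division a≋Pt+r r≋0)
  ...   | inj₂ (m , tr) = inj₂ (P∣ab⇒P∣b (suc m) b ℕₚ.≤-refl tr (HasDegree⇒< tr r-deg)
                            (∣-respʳ (*P-remainder P t b a≋Pt+r) (∣-sub P∣ab (∣-*P′ t (∣-*Pʳ P b)))))

  P^e∣ab⇒split : ∀ e A B → (P ^P e) ∣ (A *P B)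
               → Σ ℕ λ e₁ → Σ ℕ λ e₂ → e₁ Nat.+ e₂ ≡ e × (P ^P e₁) ∣ A × (P ^P e₂) ∣ B
  P^e∣ab⇒split zero    A B _ = 0 , 0 , refl , 1P-∣ A , 1P-∣ B
  P^e∣ab⇒split (suc e) A B P^e+1∣AB with irreducible⇒prime A B (∣-trans (∣-*Pʳ P (P ^P e)) P^e+1∣AB)
  ... | inj₁ (divides A′ PA′≋A)
    with P^e∣ab⇒split e A′ B
           (*P-cancel-∣ P≢0 (∣-respʳ (≋-trans (*P-congˡ B (≋-sym PA′≋A)) (*P-assoc P A′ B)) P^e+1∣AB))
  ...   | e₁ , e₂ , refl , P^e₁∣A′ , P^e₂∣B =
    suc e₁ , e₂ , refl , ∣-respʳ PA′≋A (*P-pres-∣ (∣-refl {P}) P^e₁∣A′) , P^e₂∣B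
  P^e∣ab⇒split (suc e) A B P^e+1∣AB | inj₂ (divides B′ PB′≋B)
    with P^e∣ab⇒split e A B′ (*P-cancel-∣ P≢0 (∣-respʳ AB≋P·AB′ P^e+1∣AB))
    where
    AB≋P·AB′ : (A *P B) ≋ (P *P (A *P B′))
    AB≋P·AB′ = ≋-trans (*P-congʳ A (≋-sym PB′≋B))
                 (≋-trans (≋-sym (*P-assoc A P B′)) (≋-trans (*P-congˡ B′ (*P-comm A P)) (*P-assoc P A B′)))
  ...   | e₁ , e₂ , refl , P^e₁∣A , P^e₂∣B′ =
    e₁ , suc e₂ , ℕₚ.+-suc e₁ e₂ , P^e₁∣A , ∣-respʳ PB′≋B (*P-pres-∣ (∣-refl {P}) P^e₂∣B′)


module Digits {ℓ : Level} (F : FiniteField ℓ) where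
  open FiniteField F renaming (_+_ to _+F_; _*_ to _*F_; -_ to -F_)
  open Poly F
  open Polynomial F
  open Degree F
  open Arithmetic
  open Nat using (_+_; _*_)
  open ℕₚ

  idx : Carrier → ℕ
  idx c = toℕ (index c)

  idx<q : ∀ c → idx c < q
  idx<q c = toℕ<n (index c)

  idx-injective : ∀ {c d} → idx c ≡ idx d → c ≡ d
  idx-injective {c} {d} e = trans (sym (Inverse.strictlyInverseˡ enum c))
    (trans (cong a (toℕ-injective e)) (Inverse.strictlyInverseˡ enum d))

  q>0 : 0 < q
  q>0 = ≤-<-trans z≤n (idx<q 0#)

  instance
    q≢0 : NonZero q
    q≢0 = Nat.>-nonZero q>0

  idx-0# : idx 0# ≡ 0
  idx-0# = trans (cong idx (sym (enum-0 i₀ (toℕ-fromℕ< q>0))))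
             (trans (cong toℕ (Inverse.strictlyInverseʳ enum i₀)) (toℕ-fromℕ< q>0))
    where
    i₀ : Fin q
    i₀ = fromℕ< q>0

  idx≡0⇒≡0# : ∀ {c} → idx c ≡ 0 → c ≡ 0#
  idx≡0⇒≡0# e = idx-injective (trans e (sym idx-0#))

  q≥2 : 2 ≤ q
  q≥2 with idx 1# in e
  ... | zero  = ⊥-elim (0≢1 (sym (idx≡0⇒≡0# e)))
  ... | suc k = ≤-trans (s≤s (s≤s z≤n)) (subst (_< q) e (idx<q 1#))

  -- `step` matches on q, so q is abstracted (index 0# : Fin q rules out q = 0).
  step-spec : ∀ m → Σ ℕ λ k → q ≡ suc k × idx (proj₁ (step m)) ≡ m % suc k × proj₂ (step m) ≡ m / suc k
  step-spec m with q | a | index | (λ i → cong toℕ (Inverse.strictlyInverseʳ enum i)) | index 0#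
  ... | suc k | _ | _ | index∘a≡id | _ = k , refl , trans (index∘a≡id _) (toℕ-fromℕ< _) , refl

  idx-step : ∀ m → idx (proj₁ (step m)) ≡ m % q
  idx-step m with step-spec m
  ... | k , q≡1+k , idx≡ , _ = trans idx≡ (%-congʳ (sym q≡1+k))

  proj₂-step : ∀ m → proj₂ (step m) ≡ m / q
  proj₂-step m with step-spec m
  ... | k , q≡1+k , _ , div≡ = trans div≡ (/-congʳ (sym q≡1+k))

  δ-≋[] : ∀ {f} → f ≋ [] → δ f ≡ 0
  δ-≋[] {[]}    z = refl
  δ-≋[] {c ∷ f} z =
    trans (cong₂ (λ u v → u + q * v) (trans (cong idx (at z 0)) idx-0#) (δ-≋[] {f} (mk≋ λ i → at z (suc i))))
          (*-zeroʳ q)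

  δ-cong : ∀ {f g} → f ≋ g → δ f ≡ δ g
  δ-cong {[]}    {g}     p = sym (δ-≋[] (≋-sym p))
  δ-cong {c ∷ f} {[]}    p = δ-≋[] p
  δ-cong {c ∷ f} {d ∷ g} p = cong₂ (λ u v → u + q * v) (cong idx (at p 0)) (δ-cong (∷-injectiveʳ p))

  δ≡0⇒≋[] : ∀ {f} → δ f ≡ 0 → f ≋ []
  δ≡0⇒≋[] {[]}    e = ≋-refl
  δ≡0⇒≋[] {c ∷ f} e = ≋-trans (∷-cong (idx≡0⇒≡0# (m+n≡0⇒m≡0 (idx c) e)) (δ≡0⇒≋[] δf≡0)) shift-[]
    where
    δf≡0 : δ f ≡ 0
    δf≡0 = [ (λ q≡0 → ⊥-elim (<-irrefl (sym q≡0) q>0)) , (λ x → x) ]′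
             (m*n≡0⇒m≡0∨n≡0 q (m+n≡0⇒n≡0 (idx c) e))

  δ-injective : ∀ {f g} → δ f ≡ δ g → f ≋ g
  δ-injective {[]}    {g}     e = ≋-sym (δ≡0⇒≋[] (sym e))
  δ-injective {c ∷ f} {[]}    e = δ≡0⇒≋[] e
  δ-injective {c ∷ f} {d ∷ g} e with base-unique q (idx<q c) (idx<q d) e
  ... | idx≡ , δ≡ = ∷-cong (idx-injective idx≡) (δ-injective δ≡)

  proj₂-step≤ : ∀ m fuel → m ≤ suc fuel → proj₂ (step m) ≤ fuel
  proj₂-step≤ zero    fuel _ = subst (_≤ fuel) (sym (trans (proj₂-step 0) (0/n≡0 q))) z≤n
  proj₂-step≤ (suc m) fuel m≤ =
    subst (_≤ fuel) (sym (proj₂-step (suc m))) (≤-pred (≤-trans (m/n<m (suc m) q q≥2) m≤))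

  -- The local function `go` of δ⁻¹ is not in scope; `δ⁻¹-go` is solved to
  -- it by unification in `δ⁻¹-tail`, where it is applied to distinct variables.
  mutual
    δ⁻¹-go : ℕ → ℕ → ℕ → Pol
    δ⁻¹-go = _

    δ⁻¹-tail : ∀ n → drop 1 (δ⁻¹ (suc n)) ≡ δ⁻¹-go (suc n) n (proj₂ (step (suc n)))
    δ⁻¹-tail n with proj₂ (step (suc n))
    ... | w with suc n
    ...   | K = refl

  δ-δ⁻¹-go : ∀ K fuel m → m ≤ fuel → δ (δ⁻¹-go K fuel m) ≡ m
  δ-δ⁻¹-go K zero       m m≤0 = sym (n≤0⇒n≡0 m≤0)
  δ-δ⁻¹-go K (suc fuel) m m≤  = begin
      idx (proj₁ (step m)) + q * δ (δ⁻¹-go K fuel (proj₂ (step m)))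
        ≡⟨ cong₂ (λ u v → u + q * v) (idx-step m)
                 (trans (δ-δ⁻¹-go K fuel _ (proj₂-step≤ m fuel m≤)) (proj₂-step m)) ⟩
      m % q + q * (m / q)
        ≡⟨ trans (cong (m % q +_) (*-comm q (m / q))) (sym (m≡m%n+[m/n]*n m q)) ⟩
      m ∎
    where open ≡-Reasoning

  δ-δ⁻¹ : ∀ n → δ (δ⁻¹ n) ≡ n
  δ-δ⁻¹ n = δ-δ⁻¹-go n n n ≤-refl

  δ⁻¹-δ : ∀ f → δ⁻¹ (δ f) ≋ f
  δ⁻¹-δ f = δ-injective (δ-δ⁻¹ (δ f))

  δ⁻¹-injective : ∀ {m n} → δ⁻¹ m ≋ δ⁻¹ n → m ≡ n
  δ⁻¹-injective {m} {n} p = trans (sym (δ-δ⁻¹ m)) (trans (δ-cong p) (δ-δ⁻¹ n))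

  DegreeBelow⇒δ< : ∀ D f → DegreeBelow D f → δ f < q ^ D
  DegreeBelow⇒δ< zero    f       b = subst (_< 1) (sym (δ-≋[] (DegreeBelow-0⇒≋[] b))) (s≤s z≤n)
  DegreeBelow⇒δ< (suc D) []      b = m^n>0 q (suc D)
  DegreeBelow⇒δ< (suc D) (c ∷ f) b = begin-strict
      idx c + q * δ f  <⟨ +-monoˡ-< (q * δ f) (idx<q c) ⟩
      q + q * δ f      ≡⟨ *-suc q (δ f) ⟨
      q * suc (δ f)    ≤⟨ *-monoʳ-≤ q (DegreeBelow⇒δ< D f (DegreeBelow-tail b)) ⟩
      q * q ^ D        ∎
    where open ≤-Reasoning

  δ<⇒DegreeBelow : ∀ D f → δ f < q ^ D → DegreeBelow D f
  δ<⇒DegreeBelow zero    f       δf<1 = ≋[]⇒DegreeBelow (δ≡0⇒≋[] (n<1⇒n≡0 δf<1))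
  δ<⇒DegreeBelow (suc D) []      _    = ≋[]⇒DegreeBelow ≋-refl
  δ<⇒DegreeBelow (suc D) (c ∷ f) δ<   =
    DegreeBelow-∷ (δ<⇒DegreeBelow D f (*-cancelˡ-< q (δ f) (q ^ D) (≤-<-trans (m≤n+m (q * δ f) (idx c)) δ<)))

  δ⁻¹-DegreeBelow : ∀ D n → n < q ^ D → DegreeBelow D (δ⁻¹ n)
  δ⁻¹-DegreeBelow D n n< = δ<⇒DegreeBelow D (δ⁻¹ n) (subst (_< q ^ D) (sym (δ-δ⁻¹ n)) n<)

  shiftBy : ℕ → Pol → Pol
  shiftBy zero    h = h
  shiftBy (suc D) h = shift (shiftBy D h)

  δ-+P-shiftBy : ∀ D f h → DegreeBelow D f → δ (f +P shiftBy D h) ≡ δ f + q ^ D * δ h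
  δ-+P-shiftBy zero    f       h b = begin
      δ (f +P h)        ≡⟨ δ-cong (+P-cong (DegreeBelow-0⇒≋[] b) (≋-refl {h})) ⟩
      δ h               ≡⟨ +-identityʳ (δ h) ⟨
      δ h + 0           ≡⟨ cong₂ _+_ (*-identityˡ (δ h)) (δ-≋[] (DegreeBelow-0⇒≋[] b)) ⟨
      1 * δ h + δ f     ≡⟨ +-comm _ (δ f) ⟩
      δ f + 1 * δ h     ∎
    where open ≡-Reasoning
  δ-+P-shiftBy (suc D) []      h b = begin
      idx 0# + q * δ (shiftBy D h)
        ≡⟨ cong₂ (λ u v → u + q * v) idx-0# (δ-+P-shiftBy D [] h (≋[]⇒DegreeBelow ≋-refl)) ⟩
      q * (q ^ D * δ h)
        ≡⟨ *-assoc q (q ^ D) (δ h) ⟨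
      q * q ^ D * δ h ∎
    where open ≡-Reasoning
  δ-+P-shiftBy (suc D) (c ∷ f) h b = begin
      idx (c +F 0#) + q * δ (f +P shiftBy D h)
        ≡⟨ cong₂ (λ u v → u + q * v) (cong idx (+-identityʳF c)) (δ-+P-shiftBy D f h (DegreeBelow-tail b)) ⟩
      idx c + q * (δ f + q ^ D * δ h)
        ≡⟨ regroup (idx c) q (δ f) (q ^ D) (δ h) ⟩
      idx c + q * δ f + q * q ^ D * δ h ∎
    where
    open ≡-Reasoning
    +-identityʳF : ∀ x → x +F 0# ≡ x
    +-identityʳF = IsCommutativeRing.+-identityʳ isCommutativeRing
    regroup : ∀ i x u y z → i + x * (u + y * z) ≡ i + x * u + x * y * z
    regroup = solve-∀


module Residues {ℓ : Level} (F : FiniteField ℓ) {D : ℕ} {M : Poly.Pol F} (M-deg : Degree.HasDegree F D M) where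
  open FiniteField F using (q)
  open Poly F
  open Polynomial F
  open Degree F
  open Divisibility F
  open Digits F
  open FiniteSums
  open Nat using (_+_; _*_)
  open ℕₚ
  open CommutativeRing polynomial-ring using (+-group; +-abelianGroup) renaming (setoid to ≋-setoid)
  open AbelianGroupProperties +-abelianGroup using (⁻¹-∙-comm)
  open GroupProperties +-group using (x≈y⇒x∙y⁻¹≈ε)

  instance
    q^D≢0 : NonZero (q ^ D)
    q^D≢0 = m^n≢0 q D

  sub-+P : ∀ f g h → (f -P (g +P h)) ≋ ((f -P h) -P g)
  sub-+P f g h = begin
    f +P (-P (g +P h))       ≈⟨ +P-cong (≋-refl {f}) (≋-trans (≋-sym (⁻¹-∙-comm g h)) (+P-comm (-P g) (-P h))) ⟩
    f +P ((-P h) +P (-P g))  ≈⟨ +P-assoc f (-P h) (-P g) ⟨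
    (f -P h) -P g            ∎
    where open SetoidReasoning ≋-setoid

  sub-+P-cancelʳ : ∀ f g h → ((f +P h) -P (g +P h)) ≋ (f -P g)
  sub-+P-cancelʳ f g h = begin
    (f +P h) -P (g +P h)  ≈⟨ sub-+P (f +P h) g h ⟩
    ((f +P h) -P h) -P g  ≈⟨ +P-cong (≋-trans (+P-assoc f h (-P h)) (+P-≋[]ʳ f (-P-inverseʳ h))) ≋-refl ⟩
    f -P g                ∎
    where open SetoidReasoning ≋-setoid

  δ⁻¹-block : ∀ b l → l < q ^ D → δ⁻¹ (b * q ^ D + l) ≋ (δ⁻¹ l +P shiftBy D (δ⁻¹ b))
  δ⁻¹-block b l l< = δ-injective (begin
      δ (δ⁻¹ (b * q ^ D + l))               ≡⟨ δ-δ⁻¹ _ ⟩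
      b * q ^ D + l                          ≡⟨ trans (+-comm _ l) (cong (l +_) (*-comm b (q ^ D))) ⟩
      l + q ^ D * b                          ≡⟨ cong₂ (λ x y → x + q ^ D * y) (δ-δ⁻¹ l) (δ-δ⁻¹ b) ⟨
      δ (δ⁻¹ l) + q ^ D * δ (δ⁻¹ b)         ≡⟨ δ-+P-shiftBy D (δ⁻¹ l) (δ⁻¹ b) (δ⁻¹-DegreeBelow D l l<) ⟨
      δ (δ⁻¹ l +P shiftBy D (δ⁻¹ b))        ∎)
    where open ≡-Reasoning

  multiple? : Pol → ℕ → ℕ
  multiple? g m = 𝟙 (∣-dec M-deg (g -P δ⁻¹ m))

  one-multiple-per-block : ∀ g b → ∑ (λ l → multiple? g (b * q ^ D + l)) (q ^ D) ≡ 1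
  one-multiple-per-block g b with divide M-deg (g -P shiftBy D (δ⁻¹ b))
  ... | division t r g-s≋Mt+r r-deg =
    ∑-𝟙-unique (λ l → ∣-dec M-deg (g -P δ⁻¹ (b * q ^ D + l))) (δ r) (q ^ D) δr< M∣at-δr unique
    where
    open SetoidReasoning ≋-setoid
    δr< : δ r < q ^ D
    δr< = DegreeBelow⇒δ< D r r-deg
    residue : ∀ l → l < q ^ D → (g -P δ⁻¹ (b * q ^ D + l)) ≋ ((M *P t) +P (r -P δ⁻¹ l))
    residue l l< = begin
      g -P δ⁻¹ (b * q ^ D + l)               ≈⟨ +P-cong (≋-refl {g}) (-P-cong (δ⁻¹-block b l l<)) ⟩
      g -P (δ⁻¹ l +P shiftBy D (δ⁻¹ b))      ≈⟨ sub-+P g (δ⁻¹ l) (shiftBy D (δ⁻¹ b)) ⟩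
      (g -P shiftBy D (δ⁻¹ b)) -P δ⁻¹ l      ≈⟨ +P-cong g-s≋Mt+r ≋-refl ⟩
      ((M *P t) +P r) -P δ⁻¹ l               ≈⟨ +P-assoc (M *P t) r (-P δ⁻¹ l) ⟩
      (M *P t) +P (r -P δ⁻¹ l)               ∎
    M∣at-δr : M ∣ (g -P δ⁻¹ (b * q ^ D + δ r))
    M∣at-δr = ∣-respʳ (≋-sym (residue (δ r) δr<))
      (divides t (≋-sym (+P-≋[]ʳ (M *P t) (x≈y⇒x∙y⁻¹≈ε (≋-sym (δ⁻¹-δ r))))))
    unique : ∀ l → l < q ^ D → M ∣ (g -P δ⁻¹ (b * q ^ D + l)) → l ≡ δ r
    unique l l< M∣ = δ⁻¹-injective (≋-trans (≋-sym r≋δ⁻¹l) (≋-sym (δ⁻¹-δ r)))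
      where
      r≋δ⁻¹l : r ≋ δ⁻¹ l
      r≋δ⁻¹l = ∣-sub⇒≋ M-deg r-deg (δ⁻¹-DegreeBelow D l l<)
        (∣-respʳ (+P-sub-cancelˡ (M *P t) _) (∣-sub (∣-respʳ (residue l l<) M∣) (∣-*Pʳ M t)))

  no-multiple-in-last-block : ∀ g i → i < δ g % q ^ D → multiple? g (δ g / q ^ D * q ^ D + i) ≡ 0
  no-multiple-in-last-block g i i<r = 𝟙-no M∤ (∣-dec M-deg (g -P δ⁻¹ (A * q ^ D + i)))
    where
    A r : ℕ
    A = δ g / q ^ D
    r = δ g % q ^ D
    r< : r < q ^ D
    r< = m%n<n (δ g) (q ^ D)
    i< : i < q ^ D
    i< = <-trans i<r r<
    g≋ : g ≋ (δ⁻¹ r +P shiftBy D (δ⁻¹ A))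
    g≋ = ≋-trans (≋-sym (δ⁻¹-δ g)) (≋-trans (≋-reflexive (cong δ⁻¹ δg≡)) (δ⁻¹-block A r r<))
      where
      δg≡ : δ g ≡ A * q ^ D + r
      δg≡ = trans (m≡m%n+[m/n]*n (δ g) (q ^ D)) (+-comm r _)
    M∤ : ¬ M ∣ (g -P δ⁻¹ (A * q ^ D + i))
    M∤ M∣ = <-irrefl (sym r≡i) i<r
      where
      r≡i : r ≡ i
      r≡i = δ⁻¹-injective (∣-sub⇒≋ M-deg (δ⁻¹-DegreeBelow D r r<) (δ⁻¹-DegreeBelow D i i<) (∣-respʳ difference M∣))
        where
        difference : (g -P δ⁻¹ (A * q ^ D + i)) ≋ (δ⁻¹ r -P δ⁻¹ i)
        difference = ≋-trans (+P-cong g≋ (-P-cong (δ⁻¹-block A i i<))) (sub-+P-cancelʳ (δ⁻¹ r) (δ⁻¹ i) _)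

  count-multiples : ∀ g → ∑ (multiple? g) (δ g) ≡ δ g / q ^ D
  count-multiples g = begin
      ∑ (multiple? g) (δ g)
        ≡⟨ cong (∑ (multiple? g)) (trans (m≡m%n+[m/n]*n (δ g) (q ^ D)) (+-comm r (A * q ^ D))) ⟩
      ∑ (multiple? g) (A * q ^ D + r)
        ≡⟨ ∑-+ (multiple? g) (A * q ^ D) r ⟩
      ∑ (multiple? g) (A * q ^ D) + ∑ (λ i → multiple? g (A * q ^ D + i)) r
        ≡⟨ cong₂ _+_ (∑-* (multiple? g) A (q ^ D)) (∑-zero r (λ i → no-multiple-in-last-block g i)) ⟩
      ∑ (λ b → ∑ (λ l → multiple? g (b * q ^ D + l)) (q ^ D)) A + 0
        ≡⟨ cong (_+ 0) (∑-cong A (λ b _ → one-multiple-per-block g b)) ⟩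
      ∑ (λ _ → 1) A + 0
        ≡⟨ trans (+-identityʳ _) (trans (∑-const 1 A) (*-identityʳ A)) ⟩
      A ∎
    where
    open ≡-Reasoning
    A r : ℕ
    A = δ g / q ^ D
    r = δ g % q ^ D


module BaseQ (Q : ℕ) (Q≥2 : 2 ≤ Q) where
  open Nat using (_+_; _*_; _∸_; pred)
  open ℕₚ
  open FiniteSums
  open Arithmetic

  instance
    Q≢0 : NonZero Q
    Q≢0 = Nat.>-nonZero (≤-trans (s≤s z≤n) Q≥2)

  Q′ : ℕ
  Q′ = pred Q

  Q≡1+Q′ : Q ≡ suc Q′
  Q≡1+Q′ = sym (suc-pred Q)

  Q′<Q : Q′ < Q
  Q′<Q = subst (Q′ <_) (sym Q≡1+Q′) (n<1+n Q′)

  Q^>0 : ∀ k → 0 < Q ^ k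
  Q^>0 = m^n>0 Q

  legendre : ℕ → ℕ → ℕ
  legendre zero    n = 0
  legendre (suc E) n = n / Q + legendre E (n / Q)

  legendre-∑ : ∀ E n → legendre E n ≡ ∑ (λ k → (n / Q ^ suc k) {{m^n≢0 Q (suc k)}}) E
  legendre-∑ zero    n = refl
  legendre-∑ (suc E) n = begin
      n / Q + legendre E (n / Q)
        ≡⟨ cong₂ _+_ (/-congʳ {{_}} {{m^n≢0 Q 1}} (sym (*-identityʳ Q))) (legendre-∑ E (n / Q)) ⟩
      (n / Q ^ 1) {{m^n≢0 Q 1}} + ∑ (λ k → (n / Q / Q ^ suc k) {{m^n≢0 Q (suc k)}}) E
        ≡⟨ cong (_ +_) (∑-cong E (λ k _ → m/n/o≡m/[n*o] n Q (Q ^ suc k) {{_}} {{m^n≢0 Q (suc k)}} {{m^n≢0 Q (suc (suc k))}})) ⟩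
      (n / Q ^ 1) {{m^n≢0 Q 1}} + ∑ (λ k → (n / Q ^ suc (suc k)) {{m^n≢0 Q (suc (suc k))}}) E
        ≡⟨ ∑-+ (λ k → (n / Q ^ suc k) {{m^n≢0 Q (suc k)}}) 1 E ⟨
      ∑ (λ k → (n / Q ^ suc k) {{m^n≢0 Q (suc k)}}) (suc E) ∎
    where open ≡-Reasoning

  legendre-0 : ∀ E → legendre E 0 ≡ 0
  legendre-0 zero    = refl
  legendre-0 (suc E) = trans (cong (λ x → x + legendre E x) (0/n≡0 Q)) (legendre-0 E)

  legendre-monoʳ : ∀ E {m n} → m ≤ n → legendre E m ≤ legendre E n
  legendre-monoʳ zero    m≤n = z≤n
  legendre-monoʳ (suc E) m≤n = +-mono-≤ (/-monoˡ-≤ Q m≤n) (legendre-monoʳ E (/-monoˡ-≤ Q m≤n))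

  legendre-monoˡ : ∀ {E E′} n → E ≤ E′ → legendre E n ≤ legendre E′ n
  legendre-monoˡ n z≤n          = z≤n
  legendre-monoˡ n (s≤s E≤E′)   = +-monoʳ-≤ (n / Q) (legendre-monoˡ (n / Q) E≤E′)

  legendre-<Q : ∀ E n → n < Q → legendre E n ≡ 0
  legendre-<Q zero    n n<Q = refl
  legendre-<Q (suc E) n n<Q = trans (cong (λ x → x + legendre E x) (m<n⇒m/n≡0 n<Q)) (legendre-0 E)

  /-+-≤ : ∀ m n → m / Q + n / Q ≤ (m + n) / Q
  /-+-≤ m n = begin
      m / Q + n / Q            ≡⟨ m*n/n≡m (m / Q + n / Q) Q ⟨
      (m / Q + n / Q) * Q / Q  ≤⟨ /-monoˡ-≤ Q (≤-trans (≤-reflexive (*-distribʳ-+ Q (m / Q) (n / Q)))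
                                                       (+-mono-≤ (m/n*n≤m m Q) (m/n*n≤m n Q))) ⟩
      (m + n) / Q              ∎
    where open ≤-Reasoning

  legendre-superadditive : ∀ E m n → legendre E m + legendre E n ≤ legendre E (m + n)
  legendre-superadditive zero    m n = z≤n
  legendre-superadditive (suc E) m n = begin
      legendre (suc E) m + legendre (suc E) n
        ≡⟨⟩
      (m / Q + legendre E (m / Q)) + (n / Q + legendre E (n / Q))
        ≡⟨ +-interchange (m / Q) _ (n / Q) _ ⟩
      (m / Q + n / Q) + (legendre E (m / Q) + legendre E (n / Q))
        ≤⟨ +-mono-≤ (/-+-≤ m n) (≤-trans (legendre-superadditive E (m / Q) (n / Q)) (legendre-monoʳ E (/-+-≤ m n))) ⟩
      legendre (suc E) (m + n) ∎
    where
    open ≤-Reasoning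
    +-interchange : ∀ a b c d → (a + b) + (c + d) ≡ (a + c) + (b + d)
    +-interchange = solve-∀

  *-legendre≤legendre-* : ∀ E c n → c * legendre E n ≤ legendre E (c * n)
  *-legendre≤legendre-* E zero    n = z≤n
  *-legendre≤legendre-* E (suc c) n =
    ≤-trans (+-monoʳ-≤ (legendre E n) (*-legendre≤legendre-* E c n)) (legendre-superadditive E n (c * n))

  b : ℕ → ℕ
  b zero    = 0
  b (suc j) = Q ^ j + b j

  b-suc : ∀ j → b (suc j) ≡ Q * b j + 1
  b-suc zero    = cong (_+ 1) (sym (*-zeroʳ Q))
  b-suc (suc j) = begin
      Q ^ suc j + (Q ^ j + b j)  ≡⟨ cong (Q ^ suc j +_) (b-suc j) ⟩
      Q * Q ^ j + (Q * b j + 1)  ≡⟨ regroup Q (Q ^ j) (b j) ⟩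
      Q * (Q ^ j + b j) + 1      ∎
    where
    open ≡-Reasoning
    regroup : ∀ x y z → x * y + (x * z + 1) ≡ x * (y + z) + 1
    regroup = solve-∀

  b<b-suc : ∀ j → b j < b (suc j)
  b<b-suc j = subst (b j <_) (+-comm (b j) (Q ^ j)) (m<m+n (b j) (Q^>0 j))

  b-mono-< : ∀ {i j} → i < j → b i < b j
  b-mono-< {i} {suc j} (s≤s i≤j) with m≤n⇒m<n∨m≡n i≤j
  ... | inj₁ i<j  = <-trans (b-mono-< i<j) (b<b-suc j)
  ... | inj₂ refl = b<b-suc i

  b-mono-≤ : ∀ {i j} → i ≤ j → b i ≤ b j
  b-mono-≤ i≤j with m≤n⇒m<n∨m≡n i≤j
  ... | inj₁ i<j  = <⇒≤ (b-mono-< i<j)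
  ... | inj₂ refl = ≤-refl

  b≥1 : ∀ j → 1 ≤ j → 1 ≤ b j
  b≥1 (suc j) _ = ≤-trans (Q^>0 j) (m≤m+n (Q ^ j) (b j))

  b*Q′+1≡Q^ : ∀ j → b j * Q′ + 1 ≡ Q ^ j
  b*Q′+1≡Q^ zero    = refl
  b*Q′+1≡Q^ (suc j) = begin
      (Q ^ j + b j) * Q′ + 1       ≡⟨ regroup (Q ^ j) (b j) Q′ ⟩
      Q ^ j * Q′ + (b j * Q′ + 1)  ≡⟨ cong (Q ^ j * Q′ +_) (b*Q′+1≡Q^ j) ⟩
      Q ^ j * Q′ + Q ^ j           ≡⟨ trans (+-comm (Q ^ j * Q′) (Q ^ j)) (cong (Q ^ j +_) (*-comm (Q ^ j) Q′)) ⟩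
      suc Q′ * Q ^ j               ≡⟨ cong (_* Q ^ j) Q≡1+Q′ ⟨
      Q * Q ^ j                    ∎
    where
    open ≡-Reasoning
    regroup : ∀ x y z → (x + y) * z + 1 ≡ x * z + (y * z + 1)
    regroup = solve-∀

  bNum≡b : ∀ j → bNum Q j ≡ b j
  bNum≡b j = trans (cong (λ x → divℕ (Q ^ j ∸ 1) (x ∸ 1)) Q≡1+Q′) (divide-by-Q′ Q′ refl)
    where
    Q^j∸1≡b*Q′ : Q ^ j ∸ 1 ≡ b j * Q′
    Q^j∸1≡b*Q′ = trans (cong (_∸ 1) (sym (b*Q′+1≡Q^ j))) (m+n∸n≡m (b j * Q′) 1)
    -- divℕ matches on its divisor Q′, which is nonzero as Q ≥ 2
    divide-by-Q′ : ∀ k → k ≡ Q′ → divℕ (Q ^ j ∸ 1) (suc k ∸ 1) ≡ b j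
    divide-by-Q′ zero    0≡Q′ = ⊥-elim (<-irrefl (cong suc 0≡Q′) (subst (2 ≤_) Q≡1+Q′ Q≥2))
    divide-by-Q′ (suc k) k≡Q′ = trans (cong (_/ suc k) (trans Q^j∸1≡b*Q′ (cong (b j *_) (sym k≡Q′)))) (m*n/n≡m (b j) (suc k))

  b≤legendre-Q^ : ∀ j E → j ≤ E → b j ≤ legendre E (Q ^ j)
  b≤legendre-Q^ zero    E       _         = z≤n
  b≤legendre-Q^ (suc j) (suc E) (s≤s j≤E) = begin
      Q ^ j + b j                              ≤⟨ +-monoʳ-≤ (Q ^ j) (b≤legendre-Q^ j E j≤E) ⟩
      Q ^ j + legendre E (Q ^ j)               ≡⟨ cong (λ x → x + legendre E x) (m*n/n≡m (Q ^ j) Q) ⟨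
      Q ^ j * Q / Q + legendre E (Q ^ j * Q / Q) ≡⟨ cong (λ x → x / Q + legendre E (x / Q)) (*-comm (Q ^ j) Q) ⟩
      legendre (suc E) (Q ^ suc j)             ∎
    where open ≤-Reasoning

  legendre-digit : ∀ j E c r → c < Q → r < Q ^ j → j ≤ E → legendre E (c * Q ^ j + r) ≡ c * b j + legendre E r
  legendre-digit zero E c .zero c<Q (s≤s z≤n) _ = begin
      legendre E (c * 1 + 0)  ≡⟨ legendre-<Q E (c * 1 + 0) (subst (_< Q) (sym (trans (+-identityʳ (c * 1)) (*-identityʳ c))) c<Q) ⟩
      0                       ≡⟨ cong₂ _+_ (*-zeroʳ c) (legendre-0 E) ⟨
      c * 0 + legendre E 0    ∎
    where open ≡-Reasoning
  legendre-digit (suc j) (suc E) c r c<Q r< (s≤s j≤E) = begin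
      legendre (suc E) (c * Q ^ suc j + r)
        ≡⟨ cong (λ x → x + legendre E x) shift-digit ⟩
      (c * Q ^ j + r / Q) + legendre E (c * Q ^ j + r / Q)
        ≡⟨ cong ((c * Q ^ j + r / Q) +_) (legendre-digit j E c (r / Q) c<Q r/Q< j≤E) ⟩
      (c * Q ^ j + r / Q) + (c * b j + legendre E (r / Q))
        ≡⟨ regroup c (Q ^ j) (r / Q) (b j) (legendre E (r / Q)) ⟩
      c * b (suc j) + legendre (suc E) r ∎
    where
    open ≡-Reasoning
    regroup : ∀ c x y z w → (c * x + y) + (c * z + w) ≡ c * (x + z) + (y + w)
    regroup = solve-∀
    shift-digit : (c * Q ^ suc j + r) / Q ≡ c * Q ^ j + r / Q
    shift-digit = trans (/-congˡ (cong (_+ r) (trans (cong (c *_) (*-comm Q (Q ^ j))) (sym (*-assoc c (Q ^ j) Q)))))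
      (trans (+-distrib-/-∣ˡ r (divides (c * Q ^ j) refl)) (cong (_+ r / Q) (m*n/n≡m (c * Q ^ j) Q)))
    r/Q< : r / Q < Q ^ j
    r/Q< = m<n*o⇒m/o<n (subst (r <_) (*-comm Q (Q ^ j)) r<)

  legendre-Q^∸1 : ∀ j E → j ≤ E → legendre E (Q ^ j ∸ 1) + j ≤ b j
  legendre-Q^∸1 zero    E _   = ≤-reflexive (trans (+-identityʳ _) (legendre-0 E))
  legendre-Q^∸1 (suc j) E j<E = begin
      legendre E (Q ^ suc j ∸ 1) + suc j
        ≡⟨ cong (λ x → legendre E x + suc j) Q^suc∸1 ⟩
      legendre E (Q′ * Q ^ j + (Q ^ j ∸ 1)) + suc j
        ≡⟨ cong (_+ suc j) (legendre-digit j E Q′ (Q ^ j ∸ 1) Q′<Q (∸1< (Q^>0 j)) j≤E) ⟩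
      Q′ * b j + legendre E (Q ^ j ∸ 1) + suc j
        ≡⟨ regroup (Q′ * b j) (legendre E (Q ^ j ∸ 1)) j ⟩
      Q′ * b j + (legendre E (Q ^ j ∸ 1) + j) + 1
        ≤⟨ +-monoˡ-≤ 1 (+-monoʳ-≤ (Q′ * b j) (legendre-Q^∸1 j E j≤E)) ⟩
      Q′ * b j + b j + 1
        ≡⟨ cong (_+ 1) (trans (+-comm (Q′ * b j) (b j)) (cong (_* b j) (sym Q≡1+Q′))) ⟩
      Q * b j + 1
        ≡⟨ b-suc j ⟨
      b (suc j) ∎
    where
    open ≤-Reasoning
    regroup : ∀ x y z → x + y + suc z ≡ x + (y + z) + 1
    regroup = solve-∀
    j≤E : j ≤ E
    j≤E = ≤-trans (n≤1+n j) j<E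
    Q^suc∸1 : Q ^ suc j ∸ 1 ≡ Q′ * Q ^ j + (Q ^ j ∸ 1)
    Q^suc∸1 = trans (cong (λ x → x * Q ^ j ∸ 1) Q≡1+Q′)
      (trans (cong (_∸ 1) (+-comm (Q ^ j) (Q′ * Q ^ j))) (+-∸-assoc (Q′ * Q ^ j) (Q^>0 j)))

  b<b⇒< : ∀ {i j} → b i < b j → i < j
  b<b⇒< {i} {j} bi<bj with <-cmp i j
  ... | tri< i<j _ _ = i<j
  ... | tri≈ _ refl _ = ⊥-elim (<-irrefl refl bi<bj)
  ... | tri> _ _ j<i = ⊥-elim (<-asym bi<bj (b-mono-< j<i))

  Rep : Set
  Rep = List (ℕ × ℕ)

  leadExp : Rep → ℕ
  leadExp []            = 0
  leadExp ((c , j) ∷ _) = j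

  leadExp≥1 : ∀ {R} → ValidRep Q R → 1 ≤ leadExp R
  leadExp≥1 (lastTerm _ _ j≥1)    = j≥1
  leadExp≥1 (consTerm _ _ j′<j v) = ≤-trans (leadExp≥1 v) (<⇒≤ j′<j)

  leadCoeff≥1 : ∀ {c j R} → ValidRep Q ((c , j) ∷ R) → 1 ≤ c
  leadCoeff≥1 (lastTerm c≥1 _ _)   = c≥1
  leadCoeff≥1 (consTerm c≥1 _ _ _) = c≥1

  repValue-∷ : ∀ c j R → repValue Q ((c , j) ∷ R) ≡ c * b j + repValue Q R
  repValue-∷ c j R = cong (λ x → c * x + repValue Q R) (bNum≡b j)

  repPower≥1 : ∀ {R} → ValidRep Q R → 1 ≤ repPower Q R
  repPower≥1 {(c , j) ∷ R} v = ≤-trans (*-mono-≤ (leadCoeff≥1 v) (Q^>0 j)) (m≤m+n (c * Q ^ j) (repPower Q R))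

  repPower≤ : ∀ {R} → ValidRep Q R → repPower Q R ≤ Q ^ suc (leadExp R)
  repPower≤ {(c , j) ∷ _} (lastTerm _ c≤Q _) =
    ≤-trans (≤-reflexive (+-identityʳ (c * Q ^ j))) (*-monoˡ-≤ (Q ^ j) c≤Q)
  repPower≤ {(c , j) ∷ T} (consTerm _ c<Q j′<j v) = begin
      c * Q ^ j + repPower Q T  ≤⟨ +-mono-≤ (*-monoˡ-≤ (Q ^ j) (≤-pred (subst (c <_) Q≡1+Q′ c<Q)))
                                            (≤-trans (repPower≤ v) (^-monoʳ-≤ Q j′<j)) ⟩
      Q′ * Q ^ j + Q ^ j        ≡⟨ trans (+-comm (Q′ * Q ^ j) (Q ^ j)) (cong (_* Q ^ j) (sym Q≡1+Q′)) ⟩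
      Q * Q ^ j                 ∎
    where open ≤-Reasoning

  repValue<b-suc : ∀ {R} → ValidRep Q R → repValue Q R < b (suc (leadExp R))
  repValue<b-suc {(c , j) ∷ _} (lastTerm _ c≤Q _) = begin-strict
      repValue Q ((c , j) ∷ [])  ≡⟨ trans (repValue-∷ c j []) (+-identityʳ _) ⟩
      c * b j                    ≤⟨ *-monoˡ-≤ (b j) c≤Q ⟩
      Q * b j                    <⟨ m<m+n (Q * b j) (s≤s z≤n) ⟩
      Q * b j + 1                ≡⟨ b-suc j ⟨
      b (suc j)                  ∎
    where open ≤-Reasoning
  repValue<b-suc {(c , j) ∷ T} (consTerm _ c<Q j′<j v) = begin-strict
      repValue Q ((c , j) ∷ T)   ≡⟨ repValue-∷ c j T ⟩
      c * b j + repValue Q T     <⟨ +-mono-≤-< (*-monoˡ-≤ (b j) (≤-pred (subst (c <_) Q≡1+Q′ c<Q)))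
                                               (<-≤-trans (repValue<b-suc v) (b-mono-≤ j′<j)) ⟩
      Q′ * b j + b j             ≡⟨ trans (+-comm (Q′ * b j) (b j)) (cong (_* b j) (sym Q≡1+Q′)) ⟩
      Q * b j                    <⟨ m<m+n (Q * b j) (s≤s z≤n) ⟩
      Q * b j + 1                ≡⟨ b-suc j ⟨
      b (suc j)                  ∎
    where open ≤-Reasoning

  b≤repValue : ∀ {R} → ValidRep Q R → b (leadExp R) ≤ repValue Q R
  b≤repValue {(c , j) ∷ R} v = begin
      b j                      ≡⟨ *-identityʳ (b j) ⟨
      b j * 1                  ≤⟨ *-monoʳ-≤ (b j) (leadCoeff≥1 v) ⟩
      b j * c                  ≡⟨ *-comm (b j) c ⟩
      c * b j                  ≤⟨ m≤m+n (c * b j) (repValue Q R) ⟩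
      c * b j + repValue Q R   ≡⟨ repValue-∷ c j R ⟨
      repValue Q ((c , j) ∷ R) ∎
    where open ≤-Reasoning

  repValue≥1 : ∀ {R} → ValidRep Q R → 1 ≤ repValue Q R
  repValue≥1 v = ≤-trans (b≥1 _ (leadExp≥1 v)) (b≤repValue v)

  leadExp-unique : ∀ {R R′} → ValidRep Q R → ValidRep Q R′ → repValue Q R ≡ repValue Q R′ → leadExp R ≡ leadExp R′
  leadExp-unique v v′ e = ≤-antisym (≤-pred (below v v′ e)) (≤-pred (below v′ v (sym e)))
    where
    below : ∀ {R R′} → ValidRep Q R → ValidRep Q R′ → repValue Q R ≡ repValue Q R′ → leadExp R < suc (leadExp R′)
    below v v′ e = b<b⇒< (≤-<-trans (b≤repValue v) (subst (_< _) (sym e) (repValue<b-suc v′)))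

  tail<b : ∀ {c j T} → ValidRep Q ((c , j) ∷ T) → repValue Q T < b j
  tail<b (lastTerm _ _ j≥1)    = b≥1 _ j≥1
  tail<b (consTerm _ _ j′<j v) = <-≤-trans (repValue<b-suc v) (b-mono-≤ j′<j)

  mutual
    rep-unique : ∀ {R R′} → ValidRep Q R → ValidRep Q R′ → repValue Q R ≡ repValue Q R′ → R ≡ R′
    rep-unique {(c , j) ∷ T} {(c′ , j′) ∷ T′} v v′ e with leadExp-unique v v′ e
    ... | refl with base-unique (b j) (tail<b v) (tail<b v′) (trans (sym (in-base-b c T)) (trans e (in-base-b c′ T′)))
      where
      in-base-b : ∀ c T → repValue Q ((c , j) ∷ T) ≡ repValue Q T + b j * c
      in-base-b c T = trans (repValue-∷ c j T) (trans (+-comm _ (repValue Q T)) (cong (repValue Q T +_) (*-comm c (b j))))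
    ...   | T≡T′ , refl = cong ((c , j) ∷_) (tail-unique v v′ T≡T′)

    tail-unique : ∀ {c c′ j T T′} → ValidRep Q ((c , j) ∷ T) → ValidRep Q ((c′ , j) ∷ T′)
                → repValue Q T ≡ repValue Q T′ → T ≡ T′
    tail-unique (lastTerm _ _ _)    (lastTerm _ _ _)     _ = refl
    tail-unique (lastTerm _ _ _)    (consTerm _ _ _ v′)  e = ⊥-elim (<-irrefl e (repValue≥1 v′))
    tail-unique (consTerm _ _ _ v)  (lastTerm _ _ _)     e = ⊥-elim (<-irrefl (sym e) (repValue≥1 v))
    tail-unique (consTerm _ _ _ v)  (consTerm _ _ _ v′)  e = rep-unique v v′ e

  b-bracket : ∀ e → 1 ≤ e → Σ ℕ λ j → 1 ≤ j × b j ≤ e × e < b (suc j)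
  b-bracket 1 _ = 1 , ≤-refl , ≤-refl , ≤-trans Q≥2 (≤-trans (≤-reflexive (sym (*-identityʳ Q))) (m≤m+n (Q * 1) 1))
  b-bracket (suc (suc e)) _ with b-bracket (suc e) (s≤s z≤n)
  ... | j , j≥1 , bj≤ , <b-suc with suc (suc e) <? b (suc j)
  ...   | yes e<b-suc = j , j≥1 , ≤-trans bj≤ (n≤1+n _) , e<b-suc
  ...   | no  e≮b-suc = suc j , s≤s z≤n , ≮⇒≥ e≮b-suc , ≤-<-trans <b-suc (b<b-suc (suc j))

  greedy : ∀ fuel e → e ≤ fuel → 1 ≤ e → Σ Rep λ R → ValidRep Q R × repValue Q R ≡ e
  greedy zero       e e≤0 e≥1 = ⊥-elim (<-irrefl refl (≤-trans e≥1 e≤0))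
  greedy (suc fuel) e e≤  e≥1 with b-bracket e e≥1
  ... | j , j≥1 , bj≤e , e<b-suc = build (t ≟ 0)
    where
    instance
      bj≢0 : NonZero (b j)
      bj≢0 = Nat.>-nonZero (b≥1 j j≥1)
    c t : ℕ
    c = e / b j
    t = e % b j
    e≡t+c*bj : e ≡ t + c * b j
    e≡t+c*bj = m≡m%n+[m/n]*n e (b j)
    c≥1 : 1 ≤ c
    c≥1 = m≥n⇒m/n>0 bj≤e
    c≤Q : c ≤ Q
    c≤Q = ≤-trans (/-monoˡ-≤ (b j) (≤-pred (subst (e <_) (trans (b-suc j) (+-comm _ 1)) e<b-suc)))
                  (≤-reflexive (m*n/n≡m Q (b j)))
    t<bj : t < b j
    t<bj = m%n<n e (b j)
    repValue≡e : ∀ T → repValue Q T ≡ t → repValue Q ((c , j) ∷ T) ≡ e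
    repValue≡e T T≡t = trans (repValue-∷ c j T) (trans (cong (c * b j +_) T≡t) (trans (+-comm (c * b j) t) (sym e≡t+c*bj)))
    build : Dec (t ≡ 0) → Σ Rep λ R → ValidRep Q R × repValue Q R ≡ e
    build (yes t≡0) = ((c , j) ∷ []) , lastTerm c≥1 c≤Q j≥1 , repValue≡e [] (sym t≡0)
    build (no  t≢0) with greedy fuel t (≤-pred (<-≤-trans (<-≤-trans t<bj bj≤e) e≤)) (n≢0⇒n>0 t≢0)
    ... | T , vT , T≡t = ((c , j) ∷ T) , consTerm′ vT , repValue≡e T T≡t
      where
      c<Q : c < Q
      c<Q with m≤n⇒m<n∨m≡n c≤Q
      ... | inj₁ c<Q = c<Q
      ... | inj₂ c≡Q = ⊥-elim (<-irrefl refl (<-≤-trans e<b-suc (begin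
            b (suc j)     ≡⟨ trans (b-suc j) (+-comm _ 1) ⟩
            1 + Q * b j   ≤⟨ +-monoˡ-≤ (Q * b j) (n≢0⇒n>0 t≢0) ⟩
            t + Q * b j   ≡⟨ cong (λ x → t + x * b j) c≡Q ⟨
            t + c * b j   ≡⟨ e≡t+c*bj ⟨
            e             ∎)))
        where open ≤-Reasoning
      below : ValidRep Q T → leadExp T < j
      below v = b<b⇒< (≤-<-trans (b≤repValue v) (subst (_< b j) (sym T≡t) t<bj))
      consTerm′ : ValidRep Q T → ValidRep Q ((c , j) ∷ T)
      consTerm′ v@(lastTerm _ _ _)   = consTerm c≥1 c<Q (below v) v
      consTerm′ v@(consTerm _ _ _ _) = consTerm c≥1 c<Q (below v) v

  repValue≤legendre : ∀ {R} → ValidRep Q R → ∀ E → leadExp R ≤ E → repValue Q R ≤ legendre E (repPower Q R)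
  repValue≤legendre {(c , j) ∷ T} v E j≤E = begin
      repValue Q ((c , j) ∷ T)                             ≡⟨ repValue-∷ c j T ⟩
      c * b j + repValue Q T                               ≤⟨ +-mono-≤ leading (tail v) ⟩
      legendre E (c * Q ^ j) + legendre E (repPower Q T)   ≤⟨ legendre-superadditive E (c * Q ^ j) _ ⟩
      legendre E (repPower Q ((c , j) ∷ T))                ∎
    where
    open ≤-Reasoning
    leading : c * b j ≤ legendre E (c * Q ^ j)
    leading = ≤-trans (*-monoʳ-≤ c (b≤legendre-Q^ j E j≤E)) (*-legendre≤legendre-* E c (Q ^ j))
    tail : ValidRep Q ((c , j) ∷ T) → repValue Q T ≤ legendre E (repPower Q T)
    tail (lastTerm _ _ _)      = z≤n
    tail (consTerm _ _ j′<j w) = repValue≤legendre w E (≤-trans (<⇒≤ j′<j) j≤E)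

  legendre-pred<repValue : ∀ {R} → ValidRep Q R → ∀ E → leadExp R ≤ E → legendre E (repPower Q R ∸ 1) < repValue Q R
  legendre-pred<repValue {(suc c , j) ∷ []} (lastTerm _ c<Q j≥1) E j≤E = begin-strict
      legendre E (repPower Q ((suc c , j) ∷ []) ∸ 1)  ≡⟨ cong (legendre E) power∸1 ⟩
      legendre E (c * Q ^ j + (Q ^ j ∸ 1))            ≡⟨ legendre-digit j E c (Q ^ j ∸ 1) c<Q (∸1< (Q^>0 j)) j≤E ⟩
      c * b j + legendre E (Q ^ j ∸ 1)                <⟨ +-monoʳ-< (c * b j) (<-≤-trans (m<m+n _ j≥1) (legendre-Q^∸1 j E j≤E)) ⟩
      c * b j + b j                                   ≡⟨ +-comm (c * b j) (b j) ⟩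
      suc c * b j                                     ≡⟨ trans (repValue-∷ (suc c) j []) (+-identityʳ _) ⟨
      repValue Q ((suc c , j) ∷ [])                   ∎
    where
    open ≤-Reasoning
    power∸1 : repPower Q ((suc c , j) ∷ []) ∸ 1 ≡ c * Q ^ j + (Q ^ j ∸ 1)
    power∸1 = trans (cong (_∸ 1) (trans (+-identityʳ (suc c * Q ^ j)) (+-comm (Q ^ j) (c * Q ^ j))))
                    (+-∸-assoc (c * Q ^ j) (Q^>0 j))
  legendre-pred<repValue {(c , j) ∷ T} (consTerm _ c<Q j′<j v) E j≤E = begin-strict
      legendre E (c * Q ^ j + repPower Q T ∸ 1)    ≡⟨ cong (legendre E) (+-∸-assoc (c * Q ^ j) (repPower≥1 v)) ⟩
      legendre E (c * Q ^ j + (repPower Q T ∸ 1))  ≡⟨ legendre-digit j E c (repPower Q T ∸ 1) c<Q T∸1< j≤E ⟩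
      c * b j + legendre E (repPower Q T ∸ 1)      <⟨ +-monoʳ-< (c * b j) (legendre-pred<repValue v E (≤-trans (<⇒≤ j′<j) j≤E)) ⟩
      c * b j + repValue Q T                       ≡⟨ repValue-∷ c j T ⟨
      repValue Q ((c , j) ∷ T)                     ∎
    where
    open ≤-Reasoning
    T∸1< : repPower Q T ∸ 1 < Q ^ j
    T∸1< = <-≤-trans (∸1< (repPower≥1 v)) (≤-trans (repPower≤ v) (^-monoʳ-≤ Q j′<j))

  legendre-below-repPower : ∀ {R} → ValidRep Q R → ∀ E n → n < repPower Q R → legendre E n < repValue Q R
  legendre-below-repPower {R} v E n n<power = begin-strict
      legendre E n                                   ≤⟨ legendre-monoˡ n (m≤m+n E (leadExp R)) ⟩
      legendre (E + leadExp R) n                     ≤⟨ legendre-monoʳ (E + leadExp R) (<⇒≤∸1 n<power) ⟩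
      legendre (E + leadExp R) (repPower Q R ∸ 1)    <⟨ legendre-pred<repValue v (E + leadExp R) (m≤n+m (leadExp R) E) ⟩
      repValue Q R                                   ∎
    where open ≤-Reasoning


module PrimePowersInFactorials {ℓ : Level} (F : FiniteField ℓ) (P : Poly.Pol F) {d : ℕ}
  (P-irr : Poly.Irreducible F P) (deg-P : Poly.deg F P ≡ d) (d≥1 : 1 ≤ d) where
  open FiniteField F using (q; 0≢1)
  open Poly F
  open Polynomial F
  open Degree F
  open Divisibility F
  open Canonical F
  open IrreducibleIsPrime F P P-irr deg-P
  open Digits F using (q≥2; q≢0; δ-δ⁻¹)
  open FiniteSums
  open Nat using (_+_; _*_)
  open ℕₚ

  q^d≥2 : 2 ≤ q ^ d
  q^d≥2 = ≤-trans q≥2 (≤-trans (≤-reflexive (sym (*-identityʳ q))) (^-monoʳ-≤ q d≥1))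

  open BaseQ (q ^ d) q^d≥2

  P^-HasDegree : ∀ k → HasDegree (k * d) (P ^P k)
  P^-HasDegree zero    =
    record { lead≢0 = λ 1≡0 → 0≢1 (sym 1≡0) ; below = degreeBelow λ { zero () ; (suc i) _ → refl } }
  P^-HasDegree (suc k) = *P-HasDegree P-deg (P^-HasDegree k)

  ^P-+ : ∀ m n → (P ^P (m + n)) ≋ ((P ^P m) *P (P ^P n))
  ^P-+ zero    n = ≋-sym (*P-identityˡ (P ^P n))
  ^P-+ (suc m) n = ≋-trans (*P-congʳ P (^P-+ m n)) (≋-sym (*P-assoc P (P ^P m) (P ^P n)))

  P^-∣-anti : ∀ {j k f} → j ≤ k → (P ^P k) ∣ f → (P ^P j) ∣ f
  P^-∣-anti j≤k P^k∣f with m≤n⇒m<n∨m≡n j≤k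
  ... | inj₂ refl       = P^k∣f
  ... | inj₁ (s≤s j≤k′) = P^-∣-anti j≤k′ (∣-trans (∣-*P′ P ∣-refl) P^k∣f)

  P∤1P : ¬ P ∣ 1P
  P∤1P P∣1 = 0≢1 (sym (at (∣∧DegreeBelow⇒≋[] P-deg 1P-below-d P∣1) 0))
    where
    1P-below-d : DegreeBelow d 1P
    1P-below-d = degreeBelow λ { zero d≤0 → ⊥-elim (<-irrefl refl (≤-trans d≥1 d≤0)) ; (suc i) _ → refl }

  -- valuation E f = min (E , v_P f), counted as #{k < E : P^(k+1) ∣ f}
  valuation : ℕ → Pol → ℕ
  valuation E f = ∑ (λ k → 𝟙 (∣-dec (P^-HasDegree (suc k)) f)) E

  valuation-≡ : ∀ E f → (P ^P E) ∣ f → valuation E f ≡ E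
  valuation-≡ zero    f _      = refl
  valuation-≡ (suc E) f P^E∣f  = trans (cong₂ _+_ (valuation-≡ E f (P^-∣-anti (n≤1+n E) P^E∣f))
                                                  (𝟙-yes P^E∣f (∣-dec (P^-HasDegree (suc E)) f))) (+-comm E 1)

  valuation-≥ : ∀ E f {j} → j ≤ E → (P ^P j) ∣ f → j ≤ valuation E f
  valuation-≥ E f {j} j≤E P^j∣f with m≤n⇒m<n∨m≡n j≤E
  ... | inj₂ refl = ≤-reflexive (sym (valuation-≡ j f P^j∣f))
  ... | inj₁ (s≤s {n = E′} j≤E′) =
    ≤-trans (valuation-≥ E′ f j≤E′ P^j∣f) (m≤m+n (valuation E′ f) _)

  P^valuation-∣ : ∀ E f → (P ^P valuation E f) ∣ f
  P^valuation-∣ zero    f = 1P-∣ f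
  P^valuation-∣ (suc E) f with ∣-dec (P^-HasDegree (suc E)) f
  ... | yes P^E+1∣f = subst (λ n → (P ^P n) ∣ f) (sym valuation≡E+1) P^E+1∣f
    where
    valuation≡E+1 : valuation E f + 1 ≡ suc E
    valuation≡E+1 = trans (cong (_+ 1) (valuation-≡ E f (P^-∣-anti (n≤1+n E) P^E+1∣f))) (+-comm E 1)
  ... | no  _       = subst (λ n → (P ^P n) ∣ f) (sym (+-identityʳ (valuation E f))) (P^valuation-∣ E f)

  P^e∣∏⇒e≤∑valuation : ∀ (fs : ℕ → Pol) ms e → (P ^P e) ∣ productP (map fs ms)
                     → e ≤ ∑ᴸ (λ m → valuation e (fs m)) ms
  P^e∣∏⇒e≤∑valuation fs []       zero    _      = z≤n
  P^e∣∏⇒e≤∑valuation fs []       (suc e) P^e∣1  = ⊥-elim (P∤1P (∣-trans (∣-*Pʳ P (P ^P e)) P^e∣1))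
  P^e∣∏⇒e≤∑valuation fs (m ∷ ms) e       P^e∣∏ with P^e∣ab⇒split e (fs m) (productP (map fs ms)) P^e∣∏
  ... | e₁ , e₂ , refl , P^e₁∣ , P^e₂∣ = +-mono-≤
    (valuation-≥ (e₁ + e₂) (fs m) (m≤m+n e₁ e₂) P^e₁∣)
    (≤-trans (P^e∣∏⇒e≤∑valuation fs ms e₂ P^e₂∣) (∑ᴸ-mono ms (λ m′ → ∑-monoʳ _ (m≤n+m e₂ e₁))))

  P^∑valuation∣∏ : ∀ (fs : ℕ → Pol) ms E → (P ^P ∑ᴸ (λ m → valuation E (fs m)) ms) ∣ productP (map fs ms)
  P^∑valuation∣∏ fs []       E = 1P-∣ 1P
  P^∑valuation∣∏ fs (m ∷ ms) E = ∣-respˡ (≋-sym (^P-+ (valuation E (fs m)) _))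
                                   (*P-pres-∣ (P^valuation-∣ E (fs m)) (P^∑valuation∣∏ fs ms E))

  ∑valuation-factorial : ∀ g E → ∑ᴸ (λ m → valuation E (g -P δ⁻¹ m)) (upTo (δ g)) ≡ legendre E (δ g)
  ∑valuation-factorial g E = begin
      ∑ᴸ (λ m → valuation E (g -P δ⁻¹ m)) (upTo (δ g))
        ≡⟨ ∑ᴸ-∑-comm (λ k m → 𝟙 (∣-dec (P^-HasDegree (suc k)) (g -P δ⁻¹ m))) (upTo (δ g)) E ⟩
      ∑ (λ k → ∑ᴸ (λ m → 𝟙 (∣-dec (P^-HasDegree (suc k)) (g -P δ⁻¹ m))) (upTo (δ g))) E
        ≡⟨ ∑-cong E (λ k _ → trans (∑ᴸ-upTo _ (δ g)) (count k)) ⟩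
      ∑ (λ k → (δ g / (q ^ d) ^ suc k) {{m^n≢0 (q ^ d) (suc k)}}) E
        ≡⟨ legendre-∑ E (δ g) ⟨
      legendre E (δ g) ∎
    where
    open ≡-Reasoning
    count : ∀ k → ∑ (λ m → 𝟙 (∣-dec (P^-HasDegree (suc k)) (g -P δ⁻¹ m))) (δ g)
                ≡ (δ g / (q ^ d) ^ suc k) {{m^n≢0 (q ^ d) (suc k)}}
    count k = trans (Residues.count-multiples F (P^-HasDegree (suc k)) g)
                (/-congʳ {{m^n≢0 q (suc k * d)}} {{m^n≢0 (q ^ d) (suc k)}}
                  (trans (cong (q ^_) (*-comm (suc k) d)) (sym (^-*-assoc q d (suc k)))))

  P^e∣g!⇒e≤legendre : ∀ g e → (P ^P e) ∣ (g !) → e ≤ legendre e (δ g)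
  P^e∣g!⇒e≤legendre g e P^e∣g! =
    subst (e ≤_) (∑valuation-factorial g e) (P^e∣∏⇒e≤∑valuation (λ m → g -P δ⁻¹ m) (upTo (δ g)) e P^e∣g!)

  e≤legendre⇒P^e∣g! : ∀ g e E → e ≤ legendre E (δ g) → (P ^P e) ∣ (g !)
  e≤legendre⇒P^e∣g! g e E e≤ = P^-∣-anti (subst (e ≤_) (sym (∑valuation-factorial g E)) e≤)
                                           (P^∑valuation∣∏ (λ m → g -P δ⁻¹ m) (upTo (δ g)) E)

  S[P^e]≡δ⁻¹[repPower] : ∀ {R e} → ValidRep (q ^ d) R → repValue (q ^ d) R ≡ e
                       → IsS (P ^P e) (δ⁻¹ (repPower (q ^ d) R))
  S[P^e]≡δ⁻¹[repPower] {R} {e} v refl = ∣⇒∣P divides-at-N , minimal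
    where
    N : ℕ
    N = repPower (q ^ d) R
    divides-at-N : (P ^P e) ∣ (δ⁻¹ N !)
    divides-at-N = e≤legendre⇒P^e∣g! (δ⁻¹ N) e (leadExp R)
      (subst (λ n → e ≤ legendre (leadExp R) n) (sym (δ-δ⁻¹ N)) (repValue≤legendre v (leadExp R) ≤-refl))
    minimal : ∀ h → δ h < δ (δ⁻¹ N) → ¬ (P ^P e) ∣P (h !)
    minimal h δh< P^e∣h! = <-irrefl refl (≤-<-trans (P^e∣g!⇒e≤legendre h e (∣P⇒∣ P^e∣h!))
      (legendre-below-repPower v e (δ h) (subst (δ h <_) (δ-δ⁻¹ N) δh<)))


proposition3p4 : ∀ {ℓ : Level} (F : FiniteField ℓ) → (P : Poly.Pol F) → (d : ℕ)
    → Poly.Irreducible F P → Poly.deg F P ≡ d → 1 ≤ d → (e : ℕ) → 1 ≤ e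
    → Σ (List (ℕ × ℕ)) (λ R →
        ValidRep (FiniteField.q F ^ d) R
        × repValue (FiniteField.q F ^ d) R ≡ e
        × (∀ R′ → ValidRep (FiniteField.q F ^ d) R′ → repValue (FiniteField.q F ^ d) R′ ≡ e → R′ ≡ R)
        × Poly.IsS F (Poly._^P_ F P e) (Poly.δ⁻¹ F (repPower (FiniteField.q F ^ d) R)))
proposition3p4 F P d P-irr deg-P d≥1 e e≥1 =
  let R , R-valid , R≡e = greedy e e ℕₚ.≤-refl e≥1
  in R , R-valid , R≡e , (λ R′ R′-valid R′≡e → rep-unique R′-valid R-valid (trans R′≡e (sym R≡e)))
       , S[P^e]≡δ⁻¹[repPower] R-valid R≡e
  where
  open PrimePowersInFactorials F P P-irr deg-P d≥1 using (q^d≥2; S[P^e]≡δ⁻¹[repPower])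
  open BaseQ (FiniteField.q F ^ d) q^d≥2 using (greedy; rep-unique)
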